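{- Let $G$ be a parity game with the concrete measure structure as in the context. The operator $\mathrm{prg}_+$ satisfies: (i) it maps $\mathrm{MF}_\bot$ into $\mathrm{MF}_\bot$; (ii) it is an inflationary function from quasi-dominion measures to quasi-dominion measures (i.e. for a quasi-dominion measure $\mu$, $\mu\sqsubseteq\mathrm{prg}_+(\mu)$ and $\mathrm{prg}_+(\mu)$ is a quasi-dominion measure); (iii) it maps simple measure functions to simple measure functions; (iv) every measure function $\mu$ with $\mathrm{prg}_+(\mu)=\mu$ is a progress measure over $D_+(\mu)$, i.e. for every $v\in D_+(\mu)$: if $v\in V_0$ then $\mu(w)+v\le\mu(v)$ for all $w\in E(v)$, and if $v\in V_1$ then $\mu(w)+v\le\mu(v)$ for some $w\in E(v)$.
   Context: Parity game: finite disjoint $V_0,V_1$ (positions of players 0,1), $V=V_0\cup V_1$, move relation $E\subseteq V\times V$ with $E(v)=\{w:(v,w)\in E\}\neq\emptyset$ for all $v$, priority function $p:V\to P$, $P\subset\mathbb{N}$ finite. A positional 0-strategy on $U$ is $\sigma:U\cap V_0\to V$ with $(v,\sigma(v))\in E$ (similarly for player 1); plays in $U$ from $v\in U$ are maximal sequences of positions of $U$ following the strategies; infinite plays have as priority the maximal priority occurring infinitely often. $U$ is a 0-dominion if some 0-strategy on $U$ ensures that for every 1-strategy on $U$ and $v\in U$ the play is infinite with even priority. Evaluations $\mathbb{Z}^P$ (functions $P\to\mathbb{Z}$, pointwise $+,-$), $\eta_1<\eta_2$ iff for the greatest $k$ with $\eta_1(k)\ne\eta_2(k)$: $\eta_1(k)<\eta_2(k)$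 if $k$ even, $\eta_1(k)>\eta_2(k)$ if $k$ odd; $\delta_i(i)=1$, $\delta_i(j)=0$ ($j\neq i$). Concrete measure structure: $M^+$ = $\eta\in\mathbb{Z}^P$ with all $\eta(k)\ge0$ and either $\eta=\mathbf 0$ or the greatest $k$ with $\eta(k)\ne0$ even; $M=M^+\cup\{\top\}$, $\bot=\mathbf 0$, $\eta<\top$ for $\eta\in M^+$; truncation $\top\upharpoonright_v=\top$, $(\eta\upharpoonright_v)(k)=\eta(k)$ if $k\ge p(v)$ else $0$; stretch $\top+v=\top$, $\eta+v=\max\{\bot,\eta+\delta_{p(v)}\}$. Measure functions $\mu:V\to M$, pointwise order $\sqsubseteq$. $D_0(\mu)=\{v:\mu(v)\upharpoonright_v=\top\}$, $D_\bot(\mu)=\{v:\mu(v)\upharpoonright_v=\bot\}$, $D_+(\mu)=V\setminus D_\bot(\mu)$. $\mathrm{MF}_\bot$ = measure functions with $\mu(v)=\bot$ for all $v\in D_\bot(\mu)$. Regress measure: for all $v\in D_+(\mu)\setminus D_0(\mu)$, if $v\in V_0$ then $\mu(v)\le\mu(w)+v$ for some $w\in E(v)$, if $v\in V_1$ then for all $w\in E(v)$. Quasi-dominion measure: regress measure with $D_0(\mu)$ a 0-dominion. Path measure: $\mathrm{msr}(\varepsilon)=\bot$, $\mathrm{msr}(v\cdot\pi')=\mathrm{msr}(\pi')+v$; $S(v,X)=\{\mathrm{msr}(\pi):\pi$ finite simple path from $v$ within $X$, empty path included$\}\cup\{\top\}$; simple measure function: $\mu(v)\in S(v,D_+(\mu))$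 for all $v$. Lift: $\mathrm{lift}(\mu,S,T)(v)=\max\{\mu(w)+v:w\in E(v)\cap T\}$ if $v\in S\cap V_0$; $\min\{\mu(w)+v:w\in E(v)\cap T\}$ if $v\in S\cap V_1$; $\mu(v)$ otherwise. $\mathrm{esc}(\mu,Q)=\{v\in Q\cap V_1:E(v)\setminus Q\ne\emptyset\}\cup\{v\in Q\cap V_0:\forall w\in E(v)\cap Q.\ \mu(w)+v<\mu(v)\}$. $\mathrm{bef}(\mu,Q,v)=\max\{(\mu(w)+v)-\mu(v):w\in E(v)\setminus Q\}$ for $v\in\mathrm{esc}(\mu,Q)\cap V_0$; $\min\{(\mu(w)+v)-\mu(v):w\in E(v)\setminus Q\}$ for $v\in\mathrm{esc}(\mu,Q)\cap V_1$ (differences in $\mathbb{Z}^P$); $\top$ (above all evaluations) otherwise. $\mathrm{bep}(\mu,Q)$ = positions of $Q$ of minimal forfeit, contained in $\mathrm{esc}(\mu,Q)$ (empty when the latter is empty). $\mathrm{prg}_+(\mu)$: $Q_0=D_+(\mu)$, $\mu_0=\mu$; for $i\ge0$, $E_i=\mathrm{bep}(\mu_i,Q_i)$, $Q_{i+1}=Q_i\setminus E_i$, $\mu_{i+1}=\mathrm{lift}(\mu_i,E_i,V\setminus Q_i)$; for the least $k$ with $E_k=\emptyset$, $\mathrm{prg}_+(\mu)$ is $\mu_k$ with every position of $Q_k$ reassigned the measure $\top$. -}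

module Defs where

open import Data.Nat as ℕ using (ℕ; zero; suc; _%_)
open import Data.Integer as ℤ using (ℤ; 0ℤ; 1ℤ)
open import Data.Fin as Fin using (Fin)
open import Data.Vec as Vec using (Vec; []; _∷_; lookup; tabulate; zipWith; replicate)
open import Data.Vec.Properties using (≡-dec)
open import Data.Bool using (Bool; true; false; if_then_else_; _∧_; _∨_; not)
open import Data.List as List using (List; allFin; filterᵇ; foldr; map)
open import Data.Bool.ListAction using (any; all)
open import Data.List.Relation.Unary.All as LAll using ()
open import Data.List.Relation.Unary.Unique.Propositional using (Unique)
open import Data.Product using (Σ; _×_; _,_)
open import Data.Sum using (_⊎_)
open import Data.Unit using (⊤)
open import Data.Empty using (⊥)
open import Relation.Nullary using (¬_; yes; no; does)
open import Relation.Binary.PropositionalEquality using (_≡_; _≢_)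

-- The finite priority set P ⊂ ℕ is given by its
-- strictly increasing enumeration  prio : Fin d → ℕ  (so P = image of prio,
-- and the index order on Fin d coincides with the order of priorities).
-- Evaluations ℤ^P are vectors  Vec ℤ d  (coordinate i ↔ priority prio i).
-- The priority function p : V → P is  pr : Fin n → Fin d.

record Game : Set where
  field
    n      : ℕ
    d      : ℕ
    prio   : Fin d → ℕ
    prio-strict : ∀ (i j : Fin d) → i Fin.< j → prio i ℕ.< prio j
    owner0 : Fin n → Bool
    edge   : Fin n → Fin n → Bool
    total  : ∀ (v : Fin n) → Σ (Fin n) (λ w → edge v w ≡ true)
    pr     : Fin n → Fin d

Even Odd : ℕ → Set
Even k = k % 2 ≡ 0
Odd k = k % 2 ≡ 1

evenᵇ : ℕ → Bool
evenᵇ k = (k % 2) ℕ.≡ᵇ 0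

data Msr (d : ℕ) : Set where
  val : Vec ℤ d → Msr d
  top : Msr d

-- Forfeits: evaluations (differences in ℤ^P), extended by a bottom
-- element negInf and a top element posInf (the paper's ⊤ "above all
-- evaluations").
data Fft (d : ℕ) : Set where
  negInf : Fft d
  fin    : Vec ℤ d → Fft d
  posInf : Fft d

-- Computational three-way comparison implementing the evaluation order
-- (used only inside the algorithm prg₊).
data Cmp : Set where
  LT EQ GT : Cmp

cmpAt : ℕ → ℤ → ℤ → Cmp
cmpAt k x y with x ℤ.≟ y
... | yes _ = EQ
... | no _ = if does (x ℤ.<? y)
               then (if evenᵇ k then LT else GT)
               else (if evenᵇ k then GT else LT)

cmpE : ∀ {d} → (Fin d → ℕ) → Vec ℤ d → Vec ℤ d → Cmp
cmpE {zero} pri [] [] = EQ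
cmpE {suc d} pri (x ∷ xs) (y ∷ ys) with cmpE (λ i → pri (Fin.suc i)) xs ys
... | EQ = cmpAt (pri Fin.zero) x y
... | LT = LT
... | GT = GT

zeros : ∀ {d} → Vec ℤ d
zeros = replicate _ 0ℤ

module _ (G : Game) where
  open Game G

  Pos : Set
  Pos = Fin n

  Ev : Set
  Ev = Vec ℤ d

  V0 V1 : Pos → Set
  V0 v = owner0 v ≡ true
  V1 v = owner0 v ≡ false

  E : Pos → Pos → Set
  E v w = edge v w ≡ true

  _<E_ : Ev → Ev → Set
  η₁ <E η₂ = Σ (Fin d) λ k →
      lookup η₁ k ≢ lookup η₂ k
    × (∀ (j : Fin d) → prio k ℕ.< prio j → lookup η₁ j ≡ lookup η₂ j)
    × (Even (prio k) → lookup η₁ k ℤ.< lookup η₂ k)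
    × (Odd (prio k) → lookup η₂ k ℤ.< lookup η₁ k)

  _<M_ : Msr d → Msr d → Set
  val a <M val b = a <E b
  val a <M top   = ⊤
  top   <M _     = ⊥

  _≤M_ : Msr d → Msr d → Set
  a ≤M b = a ≡ b ⊎ a <M b

  InMPlus : Ev → Set
  InMPlus η = (∀ (k : Fin d) → 0ℤ ℤ.≤ lookup η k)
    × (η ≡ zeros ⊎ Σ (Fin d) λ k → lookup η k ≢ 0ℤ
                     × (∀ (j : Fin d) → prio k ℕ.< prio j → lookup η j ≡ 0ℤ)
                     × Even (prio k))

  InM : Msr d → Set
  InM (val η) = InMPlus η
  InM top = ⊤

  botM : Msr d
  botM = val zeros

  MeasureFun : Set
  MeasureFun = Pos → Msr d

  IsMF : MeasureFun → Set
  IsMF μ = ∀ v → InM (μ v)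

  trunc : Msr d → Pos → Msr d
  trunc top v = top
  trunc (val η) v = val (tabulate λ k →
    if prio (pr v) ℕ.≤ᵇ prio k then lookup η k else 0ℤ)

  δ : Fin d → Ev
  δ i = tabulate λ j → if does (i Fin.≟ j) then 1ℤ else 0ℤ

  stretch : Msr d → Pos → Msr d
  stretch top v = top
  stretch (val η) v with cmpE prio (zipWith ℤ._+_ η (δ (pr v))) zeros
  ... | LT = botM
  ... | EQ = val (zipWith ℤ._+_ η (δ (pr v)))
  ... | GT = val (zipWith ℤ._+_ η (δ (pr v)))

  D0 Dbot Dplus : MeasureFun → Pos → Set
  D0 μ v = trunc (μ v) v ≡ top
  Dbot μ v = trunc (μ v) v ≡ botM
  Dplus μ v = ¬ Dbot μ v

  MFBot : MeasureFun → Set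
  MFBot μ = ∀ v → Dbot μ v → μ v ≡ botM

  _⊑_ : MeasureFun → MeasureFun → Set
  μ ⊑ ν = ∀ v → μ v ≤M ν v

  play : (Pos → Pos) → (Pos → Pos) → Pos → ℕ → Pos
  play σ τ v zero = v
  play σ τ v (suc k) =
    let u = play σ τ v k in if owner0 u then σ u else τ u

  EvenPriority : (ℕ → Pos) → Set
  EvenPriority x = Σ (Fin d) λ q → Even (prio q)
    × (∀ (N : ℕ) → Σ ℕ λ m → N ℕ.≤ m × pr (x m) ≡ q)
    × Σ ℕ (λ N → ∀ (m : ℕ) → N ℕ.≤ m → prio (pr (x m)) ℕ.≤ prio q)

  -- positional strategies on U are represented by total functions whose
  -- values matter only on U ∩ V₀ (resp. U ∩ V₁).  The play in U from v is
  -- infinite iff all its positions stay in U.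
  Dominion0 : (Pos → Set) → Set
  Dominion0 U = Σ (Pos → Pos) λ σ →
      (∀ v → U v → V0 v → E v (σ v))
    × (∀ (τ : Pos → Pos) → (∀ v → U v → V1 v → E v (τ v)) →
         ∀ v → U v → (∀ (k : ℕ) → U (play σ τ v k)) × EvenPriority (play σ τ v))

  Regress : MeasureFun → Set
  Regress μ = ∀ v → Dplus μ v → ¬ D0 μ v →
      (V0 v → Σ Pos λ w → E v w × (μ v ≤M stretch (μ w) v))
    × (V1 v → ∀ w → E v w → μ v ≤M stretch (μ w) v)

  QDMeasure : MeasureFun → Set
  QDMeasure μ = Regress μ × Dominion0 (D0 μ)

  ProgressOnDplus : MeasureFun → Set
  ProgressOnDplus μ = ∀ v → Dplus μ v →
      (V0 v → ∀ w → E v w → stretch (μ w) v ≤M μ v)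
    × (V1 v → Σ Pos λ w → E v w × (stretch (μ w) v ≤M μ v))

  msr : List Pos → Msr d
  msr List.[] = botM
  msr (v List.∷ π) = stretch (msr π) v

  IsPath : List Pos → Set
  IsPath List.[] = ⊤
  IsPath (x List.∷ List.[]) = ⊤
  IsPath (x List.∷ y List.∷ π) = E x y × IsPath (y List.∷ π)

  StartsAt : Pos → List Pos → Set
  StartsAt v List.[] = ⊤
  StartsAt v (x List.∷ _) = x ≡ v

  -- finite simple path from v within X (the empty path included)
  SimplePathFrom : Pos → (Pos → Set) → List Pos → Set
  SimplePathFrom v X π = StartsAt v π × IsPath π × LAll.All X π × Unique π

  InS : Pos → (Pos → Set) → Msr d → Set
  InS v X m = m ≡ top ⊎ Σ (List Pos) λ π → SimplePathFrom v X π × m ≡ msr π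

  SimpleMF : MeasureFun → Set
  SimpleMF μ = ∀ v → InS v (Dplus μ) (μ v)

  maxM minM : Msr d → Msr d → Msr d
  maxM top b = top
  maxM (val a) top = top
  maxM (val a) (val b) with cmpE prio a b
  ... | LT = val b
  ... | EQ = val a
  ... | GT = val a
  minM top b = b
  minM (val a) top = val a
  minM (val a) (val b) with cmpE prio a b
  ... | LT = val a
  ... | EQ = val a
  ... | GT = val b

  maxF minF : Fft d → Fft d → Fft d
  maxF negInf b = b
  maxF posInf b = posInf
  maxF (fin a) negInf = fin a
  maxF (fin a) posInf = posInf
  maxF (fin a) (fin b) with cmpE prio a b
  ... | LT = fin b
  ... | EQ = fin a
  ... | GT = fin a
  minF negInf b = negInf
  minF posInf b = b
  minF (fin a) negInf = negInf
  minF (fin a) posInf = fin a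
  minF (fin a) (fin b) with cmpE prio a b
  ... | LT = fin a
  ... | EQ = fin a
  ... | GT = fin b

  eqFᵇ : Fft d → Fft d → Bool
  eqFᵇ negInf negInf = true
  eqFᵇ posInf posInf = true
  eqFᵇ (fin a) (fin b) = does (≡-dec ℤ._≟_ a b)
  eqFᵇ _ _ = false

  ltMᵇ : Msr d → Msr d → Bool
  ltMᵇ top _ = false
  ltMᵇ (val a) top = true
  ltMᵇ (val a) (val b) with cmpE prio a b
  ... | LT = true
  ... | EQ = false
  ... | GT = false

  diffM : Msr d → Msr d → Fft d
  diffM (val a) (val b) = fin (zipWith ℤ._-_ a b)
  diffM top (val b) = posInf
  diffM (val a) top = negInf
  diffM top top = fin zeros

  isBotᵇ : Msr d → Bool
  isBotᵇ top = false
  isBotᵇ (val η) = does (≡-dec ℤ._≟_ η zeros)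

  Subset : Set
  Subset = Pos → Bool

  succIn : Pos → Subset → List Pos
  succIn v T = filterᵇ (λ w → edge v w ∧ T w) (allFin n)

  -- lift(μ, S, T)   (max ∅ = ⊥, min ∅ = ⊤)
  lift : MeasureFun → Subset → Subset → MeasureFun
  lift μ S T v = if S v
    then (if owner0 v
            then foldr maxM botM (map (λ w → stretch (μ w) v) (succIn v T))
            else foldr minM top (map (λ w → stretch (μ w) v) (succIn v T)))
    else μ v

  notIn : Subset → Subset
  notIn Q w = not (Q w)

  esc : MeasureFun → Subset → Subset
  esc μ Q v = Q v ∧
    (if owner0 v
       then all (λ w → ltMᵇ (stretch (μ w) v) (μ v)) (succIn v Q)
       else any (λ _ → true) (succIn v (notIn Q)))

  bef : MeasureFun → Subset → Pos → Fft d
  bef μ Q v = if esc μ Q v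
    then (if owner0 v
            then foldr maxF negInf
                   (map (λ w → diffM (stretch (μ w) v) (μ v)) (succIn v (notIn Q)))
            else foldr minF posInf
                   (map (λ w → diffM (stretch (μ w) v) (μ v)) (succIn v (notIn Q))))
    else posInf

  bep : MeasureFun → Subset → Subset
  bep μ Q v = esc μ Q v ∧ eqFᵇ (bef μ Q v)
    (foldr minF posInf (map (bef μ Q) (filterᵇ Q (allFin n))))

  finish : MeasureFun → Subset → MeasureFun
  finish μ Q v = if Q v then top else μ v

  prgLoop : ℕ → MeasureFun → Subset → MeasureFun
  prgLoop zero μ Q = finish μ Q
  prgLoop (suc k) μ Q =
    let Eᵢ = bep μ Q in
    if any Eᵢ (allFin n)
      then prgLoop k (lift μ Eᵢ (notIn Q)) (λ v → Q v ∧ not (Eᵢ v))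
      else finish μ Q

  DplusB : MeasureFun → Subset
  DplusB μ v = not (isBotᵇ (trunc (μ v) v))

  -- at most n iterations remove a nonempty set, so fuel n + 1 suffices
  prg₊ : MeasureFun → MeasureFun
  prg₊ μ = prgLoop (suc n) μ (DplusB μ)

module Submission where

-- The loop of prg₊ repeatedly removes from the region Q its best escape positions and lifts them
-- to the best value through successors outside Q; what is never removed becomes ⊤.
-- (i) and (iii) are invariants of a single lift: a lifted value is ⊥, ⊤ or the stretch of a
-- successor outside Q, so ⊥-positions stay at ⊥ and simple paths extend by one position.
-- (iv): at a fixpoint every position of D₊ is either ⊤ or was lifted without change, and an
-- unchanged lift is exactly the progress inequality.  (ii) rests on the observation that the
-- forfeit of the best escape positions never decreases from one round to the next; this makes
-- each lift inflationary and preserves the regress inequalities, and the region left at the end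
-- has no escape at all.  Player 0 keeps every play in it by moving to a successor of no smaller
-- measure (or by the dominion strategy on D₀), and on the cycle such a play ends in, an odd
-- maximal priority would make the measure truncated at that priority strictly decrease around
-- the cycle.

open import Defs
open import Data.Product using (_×_)
open import Relation.Binary.PropositionalEquality using (_≡_)

open import Data.Bool using (Bool; true; false; if_then_else_; _∧_; not; T)
open import Data.Bool.ListAction using (any; all)
open import Data.Bool.Properties using (T-≡)
open import Data.Empty using (⊥; ⊥-elim)
open import Data.Fin as Fin using (Fin)
import Data.Fin.Properties as FinP
open import Data.Integer as ℤ using (ℤ; 0ℤ; 1ℤ)
import Data.Integer.Properties as ℤP
open import Data.List as List using (List; []; _∷_; allFin; filterᵇ; foldr; map; length)
open import Data.List.Properties using (length-tabulate)
open import Data.List.Membership.Propositional using (_∈_; find; lose)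
open import Data.List.Membership.Propositional.Properties using (∈-allFin; ∈-map⁺; ∈-map⁻; ∈-filter⁺; ∈-filter⁻)
open import Data.List.Relation.Unary.All as LAll using (All; []; _∷_)
open import Data.List.Relation.Unary.All.Properties using (all⁺)
open import Data.List.Relation.Unary.Any using (here; there)
open import Data.List.Relation.Unary.Any.Properties using (any⁺; any⁻)
open import Data.List.Relation.Unary.AllPairs using ([]; _∷_)
open import Data.List.Relation.Unary.Unique.Propositional using (Unique)
open import Data.Nat as ℕ using (ℕ; zero; suc; _≤_; _<_; _+_; _*_; _%_)
open import Data.Nat.DivMod using (m%n<n)
import Data.Nat.Properties as ℕP
open import Data.Product using (Σ; _,_; proj₁; proj₂)
open import Data.Sum using (_⊎_; inj₁; inj₂)
open import Data.Unit using (⊤; tt)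
open import Data.Vec as Vec using (Vec; []; _∷_; lookup; tabulate; zipWith)
open import Data.Vec.Properties using (≡-dec; lookup-replicate; lookup∘tabulate; lookup-zipWith; zipWith-comm; zipWith-assoc)
open import Function using (_∘_; case_of_)
open import Function.Bundles using (Equivalence)
open import Relation.Binary using (tri<; tri≈; tri>)
open import Relation.Binary.PropositionalEquality using (_≢_; refl; sym; trans; cong; cong₂; subst; subst₂; module ≡-Reasoning)
open import Relation.Nullary using (¬_; yes; no; does)
open import Relation.Nullary.Decidable using (T?)

flipCmp : Cmp → Cmp
flipCmp LT = GT
flipCmp EQ = EQ
flipCmp GT = LT

posC negC : ℕ → Cmp
posC k = if evenᵇ k then LT else GT
negC k = if evenᵇ k then GT else LT

cmpAt-refl : ∀ k x → cmpAt k x x ≡ EQ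
cmpAt-refl k x with x ℤ.≟ x
... | yes _ = refl
... | no x≢x = ⊥-elim (x≢x refl)

cmpAt-< : ∀ k x y → x ℤ.< y → cmpAt k x y ≡ posC k
cmpAt-< k x y x<y with x ℤ.≟ y
... | yes x≡y = ⊥-elim (ℤP.<⇒≢ x<y x≡y)
... | no _ with x ℤ.<? y
...   | yes _ = refl
...   | no x≮y = ⊥-elim (x≮y x<y)

cmpAt-> : ∀ k x y → y ℤ.< x → cmpAt k x y ≡ negC k
cmpAt-> k x y y<x with x ℤ.≟ y
... | yes x≡y = ⊥-elim (ℤP.<⇒≢ y<x (sym x≡y))
... | no _ with x ℤ.<? y
...   | yes x<y = ⊥-elim (ℤP.<-asym x<y y<x)
...   | no _ = refl

data CmpAtView (k : ℕ) (x y : ℤ) : Cmp → Set where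
  less    : x ℤ.< y → CmpAtView k x y (posC k)
  equal   : x ≡ y → CmpAtView k x y EQ
  greater : y ℤ.< x → CmpAtView k x y (negC k)

cmpAt-view : ∀ k x y → CmpAtView k x y (cmpAt k x y)
cmpAt-view k x y with ℤP.<-cmp x y
... | tri< x<y _ _ rewrite cmpAt-< k x y x<y = less x<y
... | tri≈ _ refl _ rewrite cmpAt-refl k x = equal refl
... | tri> _ _ y<x rewrite cmpAt-> k x y y<x = greater y<x

cmpAt-EQ : ∀ k x y → cmpAt k x y ≡ EQ → x ≡ y
cmpAt-EQ k x y h with x ℤ.≟ y
... | yes x≡y = x≡y
... | no _ with does (x ℤ.<? y) | evenᵇ k
cmpAt-EQ k x y () | no _ | true  | true
cmpAt-EQ k x y () | no _ | true  | false
cmpAt-EQ k x y () | no _ | false | true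
cmpAt-EQ k x y () | no _ | false | false

negC≡flip-posC : ∀ k → negC k ≡ flipCmp (posC k)
negC≡flip-posC k with evenᵇ k
... | true = refl
... | false = refl

posC≡flip-negC : ∀ k → posC k ≡ flipCmp (negC k)
posC≡flip-negC k with evenᵇ k
... | true = refl
... | false = refl

cmpAt-flip : ∀ k x y → cmpAt k y x ≡ flipCmp (cmpAt k x y)
cmpAt-flip k x y with cmpAt k x y | cmpAt-view k x y
... | _ | less x<y = trans (cmpAt-> k y x x<y) (negC≡flip-posC k)
... | _ | equal refl = cmpAt-refl k x
... | _ | greater y<x = trans (cmpAt-< k y x y<x) (posC≡flip-negC k)

cmpAt-shift : ∀ k x y c → cmpAt k (x ℤ.+ c) (y ℤ.+ c) ≡ cmpAt k x y
cmpAt-shift k x y c with cmpAt k x y | cmpAt-view k x y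
... | _ | less x<y = cmpAt-< k _ _ (ℤP.+-monoˡ-< c x<y)
... | _ | equal refl = cmpAt-refl k (x ℤ.+ c)
... | _ | greater y<x = cmpAt-> k _ _ (ℤP.+-monoˡ-< c y<x)

data LTAt (k : ℕ) (x y : ℤ) : Set where
  even-< : evenᵇ k ≡ true → x ℤ.< y → LTAt k x y
  odd->  : evenᵇ k ≡ false → y ℤ.< x → LTAt k x y

cmpAt-LT : ∀ k x y → cmpAt k x y ≡ LT → LTAt k x y
cmpAt-LT k x y h with cmpAt k x y | cmpAt-view k x y | evenᵇ k in ev
... | _ | less x<y    | true  = even-< ev x<y
... | _ | greater y<x | false = odd-> ev y<x
... | _ | equal _     | _     = case h of λ ()
... | _ | less _      | false rewrite ev = case h of λ ()
... | _ | greater _   | true  rewrite ev = case h of λ ()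

LTAt⇒cmpAt : ∀ k x y → LTAt k x y → cmpAt k x y ≡ LT
LTAt⇒cmpAt k x y (even-< ev x<y) rewrite cmpAt-< k x y x<y | ev = refl
LTAt⇒cmpAt k x y (odd-> ev y<x) rewrite cmpAt-> k x y y<x | ev = refl

cmpAt-trans : ∀ k x y z → cmpAt k x y ≡ LT → cmpAt k y z ≡ LT → cmpAt k x z ≡ LT
cmpAt-trans k x y z h₁ h₂ with cmpAt-LT k x y h₁ | cmpAt-LT k y z h₂
... | even-< ev x<y | even-< _ y<z = LTAt⇒cmpAt k x z (even-< ev (ℤP.<-trans x<y y<z))
... | odd-> ev y<x  | odd-> _ z<y  = LTAt⇒cmpAt k x z (odd-> ev (ℤP.<-trans z<y y<x))
... | even-< ev _   | odd-> ev′ _  = case trans (sym ev) ev′ of λ ()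
... | odd-> ev _    | even-< ev′ _ = case trans (sym ev′) ev of λ ()

_⊕_ _⊖_ : ∀ {d} → Vec ℤ d → Vec ℤ d → Vec ℤ d
_⊕_ = zipWith ℤ._+_
_⊖_ = zipWith ℤ._-_

cmpE-refl : ∀ {d} (pri : Fin d → ℕ) a → cmpE pri a a ≡ EQ
cmpE-refl {zero} pri [] = refl
cmpE-refl {suc d} pri (x ∷ xs) rewrite cmpE-refl (pri ∘ Fin.suc) xs = cmpAt-refl _ x

cmpE-EQ : ∀ {d} (pri : Fin d → ℕ) a b → cmpE pri a b ≡ EQ → a ≡ b
cmpE-EQ {zero} pri [] [] h = refl
cmpE-EQ {suc d} pri (x ∷ xs) (y ∷ ys) h with cmpE (pri ∘ Fin.suc) xs ys in e
... | EQ = cong₂ _∷_ (cmpAt-EQ _ x y h) (cmpE-EQ _ xs ys e)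
cmpE-EQ {suc d} pri (x ∷ xs) (y ∷ ys) () | LT
cmpE-EQ {suc d} pri (x ∷ xs) (y ∷ ys) () | GT

cmpE-flip : ∀ {d} (pri : Fin d → ℕ) a b → cmpE pri b a ≡ flipCmp (cmpE pri a b)
cmpE-flip {zero} pri [] [] = refl
cmpE-flip {suc d} pri (x ∷ xs) (y ∷ ys)
  rewrite cmpE-flip (pri ∘ Fin.suc) xs ys
  with cmpE (pri ∘ Fin.suc) xs ys
... | LT = refl
... | EQ = cmpAt-flip _ x y
... | GT = refl

cmpE-shift : ∀ {d} (pri : Fin d → ℕ) a b c → cmpE pri (a ⊕ c) (b ⊕ c) ≡ cmpE pri a b
cmpE-shift {zero} pri [] [] [] = refl
cmpE-shift {suc d} pri (x ∷ xs) (y ∷ ys) (z ∷ zs)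
  rewrite cmpE-shift (pri ∘ Fin.suc) xs ys zs
  with cmpE (pri ∘ Fin.suc) xs ys
... | LT = refl
... | EQ = cmpAt-shift _ x y z
... | GT = refl

cmpE-trans : ∀ {d} (pri : Fin d → ℕ) a b c → cmpE pri a b ≡ LT → cmpE pri b c ≡ LT → cmpE pri a c ≡ LT
cmpE-trans {zero} pri [] [] [] () _
cmpE-trans {suc d} pri (x ∷ xs) (y ∷ ys) (z ∷ zs) h₁ h₂
  with cmpE (pri ∘ Fin.suc) xs ys in e₁ | cmpE (pri ∘ Fin.suc) ys zs in e₂
... | LT | LT rewrite cmpE-trans _ xs ys zs e₁ e₂ = refl
... | LT | EQ rewrite cmpE-EQ _ ys zs e₂ | e₁ = refl
... | EQ | LT rewrite cmpE-EQ _ xs ys e₁ | e₂ = refl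
... | EQ | EQ rewrite cmpE-EQ _ xs ys e₁ | cmpE-EQ _ ys zs e₂ | cmpE-refl (pri ∘ Fin.suc) zs =
  cmpAt-trans _ x y z h₁ h₂
... | GT | _  = case h₁ of λ ()
... | LT | GT = case h₂ of λ ()
... | EQ | GT = case h₂ of λ ()

⊕-comm : ∀ {d} (a b : Vec ℤ d) → a ⊕ b ≡ b ⊕ a
⊕-comm = zipWith-comm ℤP.+-comm

⊕-assoc : ∀ {d} (a b c : Vec ℤ d) → (a ⊕ b) ⊕ c ≡ a ⊕ (b ⊕ c)
⊕-assoc = zipWith-assoc ℤP.+-assoc

⊖-⊕-cancel : ∀ {d} (a b : Vec ℤ d) → (a ⊖ b) ⊕ b ≡ a
⊖-⊕-cancel [] [] = refl
⊖-⊕-cancel (x ∷ a) (y ∷ b) = cong₂ _∷_ x-y+y≡x (⊖-⊕-cancel a b)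
  where x-y+y≡x : (x ℤ.- y) ℤ.+ y ≡ x
        x-y+y≡x = trans (ℤP.+-assoc x (ℤ.- y) y) (trans (cong (λ t → x ℤ.+ t) (ℤP.+-inverseˡ y)) (ℤP.+-identityʳ x))

⊕-⊖-cancel : ∀ {d} (a b : Vec ℤ d) → (a ⊕ b) ⊖ b ≡ a
⊕-⊖-cancel [] [] = refl
⊕-⊖-cancel (x ∷ a) (y ∷ b) = cong₂ _∷_ x+y-y≡x (⊕-⊖-cancel a b)
  where x+y-y≡x : (x ℤ.+ y) ℤ.- y ≡ x
        x+y-y≡x = trans (ℤP.+-assoc x y (ℤ.- y)) (trans (cong (λ t → x ℤ.+ t) (ℤP.+-inverseʳ y)) (ℤP.+-identityʳ x))

⊕-⊖-cancelˡ : ∀ {d} (a b : Vec ℤ d) → b ⊕ (a ⊖ b) ≡ a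
⊕-⊖-cancelˡ a b = trans (⊕-comm b (a ⊖ b)) (⊖-⊕-cancel a b)

⊖≡⊕-neg : ∀ {d} (a b : Vec ℤ d) → a ⊖ b ≡ a ⊕ Vec.map ℤ.-_ b
⊖≡⊕-neg [] [] = refl
⊖≡⊕-neg (x ∷ a) (y ∷ b) = cong (_ ∷_) (⊖≡⊕-neg a b)

∧-true : ∀ {a b} → a ∧ b ≡ true → a ≡ true × b ≡ true
∧-true {true} {true} _ = refl , refl

false≢true : false ≢ true
false≢true ()

if-true : ∀ {A : Set} (b : Bool) (x y : A) → b ≡ true → (if b then x else y) ≡ x
if-true true x y _ = refl

if-false : ∀ {A : Set} (b : Bool) (x y : A) → b ≡ false → (if b then x else y) ≡ y
if-false false x y _ = refl

module _ {A : Set} (p : A → Bool) where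

  all-true : ∀ xs → all p xs ≡ true → ∀ x → x ∈ xs → p x ≡ true
  all-true xs h x x∈xs = Equivalence.to T-≡ (LAll.lookup (all⁺ p xs (Equivalence.from T-≡ h)) x∈xs)

  any-true : ∀ xs → any p xs ≡ true → Σ A λ x → x ∈ xs × p x ≡ true
  any-true xs h with find (any⁻ p xs (Equivalence.from T-≡ h))
  ... | x , x∈xs , px = x , x∈xs , Equivalence.to T-≡ px

  any-intro : ∀ xs x → x ∈ xs → p x ≡ true → any p xs ≡ true
  any-intro xs x x∈xs px = Equivalence.to T-≡ (any⁺ p (lose x∈xs (Equivalence.from T-≡ px)))

  all-false : ∀ xs → all p xs ≡ false → Σ A λ x → x ∈ xs × p x ≡ false
  all-false (y ∷ xs) h with p y in py
  ... | false = y , here refl , py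
  ... | true with all-false xs h
  ...   | x , x∈xs , px = x , there x∈xs , px

  any-false : ∀ xs → any p xs ≡ false → ∀ x → x ∈ xs → p x ≡ false
  any-false (y ∷ xs) h x x∈y∷xs with p y in py | x∈y∷xs
  ... | false | here refl = py
  ... | false | there x∈xs = any-false xs h x x∈xs

  ∈-filterᵇ⁺ : ∀ {xs} x → x ∈ xs → p x ≡ true → x ∈ filterᵇ p xs
  ∈-filterᵇ⁺ x x∈xs px = ∈-filter⁺ (T? ∘ p) x∈xs (Equivalence.from T-≡ px)

  ∈-filterᵇ⁻ : ∀ {xs} x → x ∈ filterᵇ p xs → x ∈ xs × p x ≡ true
  ∈-filterᵇ⁻ x x∈ with ∈-filter⁻ (T? ∘ p) x∈
  ... | x∈xs , px = x∈xs , Equivalence.to T-≡ px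

any-const-false : ∀ {A : Set} (xs : List A) → any (λ _ → true) xs ≡ false → xs ≡ []
any-const-false [] _ = refl

countᵇ : ∀ {A : Set} → (A → Bool) → List A → ℕ
countᵇ p l = length (filterᵇ p l)

countᵇ-mono : ∀ {A : Set} (p q : A → Bool) l → (∀ x → p x ≡ true → q x ≡ true) → countᵇ p l ≤ countᵇ q l
countᵇ-mono p q [] h = ℕ.z≤n
countᵇ-mono p q (y ∷ l) h with p y in e1 | q y in e2
... | true | true = ℕ.s≤s (countᵇ-mono p q l h)
... | true | false = ⊥-elim (false≢true (trans (sym e2) (h y e1)))
... | false | true = ℕP.m≤n⇒m≤1+n (countᵇ-mono p q l h)
... | false | false = countᵇ-mono p q l h

countᵇ-strict : ∀ {A : Set} (p q : A → Bool) l u → u ∈ l → p u ≡ false → q u ≡ true →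
  (∀ x → p x ≡ true → q x ≡ true) → countᵇ p l < countᵇ q l
countᵇ-strict p q (y ∷ l) .y (here refl) pu qu h rewrite pu | qu = ℕ.s≤s (countᵇ-mono p q l h)
countᵇ-strict p q (y ∷ l) u (there m) pu qu h with p y in e1 | q y in e2
... | true | true = ℕ.s≤s (countᵇ-strict p q l u m pu qu h)
... | true | false = ⊥-elim (false≢true (trans (sym e2) (h y e1)))
... | false | true = ℕP.m≤n⇒m≤1+n (countᵇ-strict p q l u m pu qu h)
... | false | false = countᵇ-strict p q l u m pu qu h

countᵇ-≤-length : ∀ {A : Set} (p : A → Bool) l → countᵇ p l ≤ length l
countᵇ-≤-length p [] = ℕ.z≤n
countᵇ-≤-length p (y ∷ l) with p y
... | true = ℕ.s≤s (countᵇ-≤-length p l)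
... | false = ℕP.m≤n⇒m≤1+n (countᵇ-≤-length p l)

even-or-odd : ∀ k → Even k ⊎ Odd k
even-or-odd k with k % 2 | m%n<n k 2
... | 0 | _ = inj₁ refl
... | 1 | _ = inj₂ refl
... | suc (suc _) | ℕ.s≤s (ℕ.s≤s ())

Even⇒evenᵇ : ∀ k → Even k → evenᵇ k ≡ true
Even⇒evenᵇ k e rewrite e = refl

Odd⇒evenᵇ : ∀ k → Odd k → evenᵇ k ≡ false
Odd⇒evenᵇ k o rewrite o = refl

¬Even∧Odd : ∀ k → Even k → Odd k → ⊥
¬Even∧Odd k e o = case trans (sym e) o of λ ()

-- The order _<E_, for an arbitrary priority enumeration.
PrioLt : ∀ {d} → (Fin d → ℕ) → Vec ℤ d → Vec ℤ d → Set
PrioLt {d} pri η₁ η₂ = Σ (Fin d) λ k →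
      lookup η₁ k ≢ lookup η₂ k
    × (∀ (j : Fin d) → pri k ℕ.< pri j → lookup η₁ j ≡ lookup η₂ j)
    × (Even (pri k) → lookup η₁ k ℤ.< lookup η₂ k)
    × (Odd (pri k) → lookup η₂ k ℤ.< lookup η₁ k)

StrictlyIncreasing : ∀ {d} → (Fin d → ℕ) → Set
StrictlyIncreasing {d} pri = ∀ (i j : Fin d) → i Fin.< j → pri i ℕ.< pri j

StrictlyIncreasing-suc : ∀ {d} {pri : Fin (suc d) → ℕ} → StrictlyIncreasing pri → StrictlyIncreasing (pri ∘ Fin.suc)
StrictlyIncreasing-suc inc i j i<j = inc (Fin.suc i) (Fin.suc j) (ℕ.s≤s i<j)

lookup-ext : ∀ {d} (xs ys : Vec ℤ d) → (∀ i → lookup xs i ≡ lookup ys i) → xs ≡ ys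
lookup-ext [] [] h = refl
lookup-ext (x ∷ xs) (y ∷ ys) h = cong₂ _∷_ (h Fin.zero) (lookup-ext xs ys (h ∘ Fin.suc))

-- cmpE compares from the last coordinate, which carries the greatest priority.
cmpE⇒PrioLt : ∀ {d} (pri : Fin d → ℕ) → StrictlyIncreasing pri → ∀ a b → cmpE pri a b ≡ LT → PrioLt pri a b
cmpE⇒PrioLt {zero} pri inc [] [] ()
cmpE⇒PrioLt {suc d} pri inc (x ∷ xs) (y ∷ ys) h
  with cmpE (pri ∘ Fin.suc) xs ys in e
... | LT with cmpE⇒PrioLt (pri ∘ Fin.suc) (StrictlyIncreasing-suc inc) xs ys e
...   | k , ne , above , ev , od = Fin.suc k , ne , above′ , ev , od
  where above′ : ∀ j → pri (Fin.suc k) ℕ.< pri j → lookup (x ∷ xs) j ≡ lookup (y ∷ ys) j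
        above′ Fin.zero lt = ⊥-elim (ℕP.<-asym lt (inc Fin.zero (Fin.suc k) (ℕ.s≤s ℕ.z≤n)))
        above′ (Fin.suc j) lt = above j lt
cmpE⇒PrioLt {suc d} pri inc (x ∷ xs) (y ∷ ys) h | EQ with cmpE-EQ _ xs ys e
... | refl with cmpAt-LT (pri Fin.zero) x y h
...   | even-< ev x<y = Fin.zero , ℤP.<⇒≢ x<y , above , (λ _ → x<y) ,
                        (λ o → ⊥-elim (case trans (sym ev) (Odd⇒evenᵇ (pri Fin.zero) o) of λ ()))
  where above : ∀ j → pri Fin.zero ℕ.< pri j → lookup (x ∷ xs) j ≡ lookup (y ∷ xs) j
        above Fin.zero lt = ⊥-elim (ℕP.<-irrefl refl lt)
        above (Fin.suc j) lt = refl
...   | odd-> ev y<x = Fin.zero , (λ x≡y → ℤP.<⇒≢ y<x (sym x≡y)) , above ,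
                        (λ e′ → ⊥-elim (case trans (sym (Even⇒evenᵇ (pri Fin.zero) e′)) ev of λ ())) , (λ _ → y<x)
  where above : ∀ j → pri Fin.zero ℕ.< pri j → lookup (x ∷ xs) j ≡ lookup (y ∷ xs) j
        above Fin.zero lt = ⊥-elim (ℕP.<-irrefl refl lt)
        above (Fin.suc j) lt = refl

PrioLt⇒cmpE : ∀ {d} (pri : Fin d → ℕ) → StrictlyIncreasing pri → ∀ a b → PrioLt pri a b → cmpE pri a b ≡ LT
PrioLt⇒cmpE {zero} pri inc [] [] (() , _)
PrioLt⇒cmpE {suc d} pri inc (x ∷ xs) (y ∷ ys) (Fin.zero , ne , above , ev , od)
  with lookup-ext xs ys (λ i → above (Fin.suc i) (inc Fin.zero (Fin.suc i) (ℕ.s≤s ℕ.z≤n)))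
... | refl rewrite cmpE-refl (pri ∘ Fin.suc) xs with even-or-odd (pri Fin.zero)
...   | inj₁ e = LTAt⇒cmpAt (pri Fin.zero) x y (even-< (Even⇒evenᵇ (pri Fin.zero) e) (ev e))
...   | inj₂ o = LTAt⇒cmpAt (pri Fin.zero) x y (odd-> (Odd⇒evenᵇ (pri Fin.zero) o) (od o))
PrioLt⇒cmpE {suc d} pri inc (x ∷ xs) (y ∷ ys) (Fin.suc k , ne , above , ev , od)
  rewrite PrioLt⇒cmpE (pri ∘ Fin.suc) (StrictlyIncreasing-suc inc) xs ys
            (k , ne , (λ j → above (Fin.suc j)) , ev , od) = refl

module SelectiveFold {A : Set} (_≼_ : A → A → Set)
  (≼-trans : ∀ {a b c} → a ≼ b → b ≼ c → a ≼ c)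
  (_⊔_ : A → A → A)
  (⊔-sel : ∀ a b → a ⊔ b ≡ a ⊎ a ⊔ b ≡ b)
  (x≼x⊔y : ∀ a b → a ≼ (a ⊔ b)) (y≼x⊔y : ∀ a b → b ≼ (a ⊔ b)) where

  fold-sel : ∀ base xs → foldr _⊔_ base xs ≡ base ⊎ Σ A (λ x → x ∈ xs × foldr _⊔_ base xs ≡ x)
  fold-sel base [] = inj₁ refl
  fold-sel base (x ∷ xs) with ⊔-sel x (foldr _⊔_ base xs)
  ... | inj₁ p = inj₂ (x , here refl , p)
  ... | inj₂ p with fold-sel base xs
  ...   | inj₁ q = inj₁ (trans p q)
  ...   | inj₂ (y , y∈xs , q) = inj₂ (y , there y∈xs , trans p q)

  fold-ub : ∀ base xs x → x ∈ xs → x ≼ foldr _⊔_ base xs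
  fold-ub base (y ∷ xs) .y (here refl) = x≼x⊔y y _
  fold-ub base (y ∷ xs) x (there x∈xs) = ≼-trans (fold-ub base xs x x∈xs) (y≼x⊔y y _)

  fold-all : ∀ (P : A → Set) base xs → P base → (∀ x → x ∈ xs → P x) → P (foldr _⊔_ base xs)
  fold-all P base xs pb h with fold-sel base xs
  ... | inj₁ e rewrite e = pb
  ... | inj₂ (x , x∈xs , e) rewrite e = h x x∈xs

argmax≤ : ∀ (g : ℕ → ℕ) L′ → Σ ℕ λ r → r ≤ L′ × (∀ s → s ≤ L′ → g s ≤ g r)
argmax≤ g zero = 0 , ℕ.z≤n , λ { zero _ → ℕP.≤-refl }
argmax≤ g (suc L′) with argmax≤ g L′
... | r , r≤L′ , max with g (suc L′) ℕ.≤? g r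
...   | yes p = r , ℕP.m≤n⇒m≤1+n r≤L′ , max′
  where max′ : ∀ s → s ≤ suc L′ → g s ≤ g r
        max′ s le with ℕP.m≤n⇒m<n∨m≡n le
        ... | inj₁ lt = max s (ℕP.≤-pred lt)
        ... | inj₂ refl = p
...   | no np = suc L′ , ℕP.≤-refl , max′
  where max′ : ∀ s → s ≤ suc L′ → g s ≤ g (suc L′)
        max′ s le with ℕP.m≤n⇒m<n∨m≡n le
        ... | inj₁ lt = ℕP.≤-trans (max s (ℕP.≤-pred lt)) (ℕP.<⇒≤ (ℕP.≰⇒> np))
        ... | inj₂ refl = ℕP.≤-refl

module _ (G : Game) where

  open Game G

  -- prg₊ compares with cmpE; we reason with the orders below and convert to _<E_ and _≤M_
  -- only where the statement needs them.
  LtV LeV : Vec ℤ d → Vec ℤ d → Set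
  LtV a b = cmpE prio a b ≡ LT
  LeV a b = LtV a b ⊎ a ≡ b

  LtV-irrefl : ∀ a → ¬ LtV a a
  LtV-irrefl a h = case trans (sym (cmpE-refl prio a)) h of λ ()

  LtV-trans : ∀ {a b c} → LtV a b → LtV b c → LtV a c
  LtV-trans {a} {b} {c} = cmpE-trans prio a b c

  LeV-refl : ∀ {a} → LeV a a
  LeV-refl = inj₂ refl

  LeV-trans : ∀ {a b c} → LeV a b → LeV b c → LeV a c
  LeV-trans (inj₁ p) (inj₁ q) = inj₁ (LtV-trans p q)
  LeV-trans (inj₁ p) (inj₂ refl) = inj₁ p
  LeV-trans (inj₂ refl) q = q

  LeV-LtV-trans : ∀ {a b c} → LeV a b → LtV b c → LtV a c
  LeV-LtV-trans (inj₁ p) q = LtV-trans p q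
  LeV-LtV-trans (inj₂ refl) q = q

  LtV-LeV-trans : ∀ {a b c} → LtV a b → LeV b c → LtV a c
  LtV-LeV-trans p (inj₁ q) = LtV-trans p q
  LtV-LeV-trans p (inj₂ refl) = p

  LtV-asym : ∀ {a b} → LtV a b → ¬ LeV b a
  LtV-asym {a} p q = LtV-irrefl a (LtV-LeV-trans p q)

  LeV-antisym : ∀ {a b} → LeV a b → LeV b a → a ≡ b
  LeV-antisym (inj₂ p) _ = p
  LeV-antisym (inj₁ p) q = ⊥-elim (LtV-asym p q)

  GT⇒LtV : ∀ a b → cmpE prio a b ≡ GT → LtV b a
  GT⇒LtV a b h rewrite cmpE-flip prio a b | h = refl

  LtV-shift : ∀ a b c → LtV a b → LtV (a ⊕ c) (b ⊕ c)
  LtV-shift a b c h = trans (cmpE-shift prio a b c) h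

  LeV-shift : ∀ a b c → LeV a b → LeV (a ⊕ c) (b ⊕ c)
  LeV-shift a b c (inj₁ h) = inj₁ (LtV-shift a b c h)
  LeV-shift a b c (inj₂ refl) = inj₂ refl

  LeV-add : ∀ a b c e → LeV a b → LeV c e → LeV (a ⊕ c) (b ⊕ e)
  LeV-add a b c e p q = LeV-trans (LeV-shift a b c p)
    (subst₂ LeV (⊕-comm c b) (⊕-comm e b) (LeV-shift c e b q))

  LeV-sub : ∀ a b c → LeV a b → LeV (a ⊖ c) (b ⊖ c)
  LeV-sub a b c h rewrite ⊖≡⊕-neg a c | ⊖≡⊕-neg b c = LeV-shift a b _ h

  LtV⇒<E : ∀ a b → LtV a b → _<E_ G a b
  LtV⇒<E a b = cmpE⇒PrioLt prio prio-strict a b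

  <E⇒LtV : ∀ a b → _<E_ G a b → LtV a b
  <E⇒LtV a b = PrioLt⇒cmpE prio prio-strict a b

  leM : Msr d → Msr d → Set
  leM (val a) (val b) = LeV a b
  leM (val a) top = ⊤
  leM top top = ⊤
  leM top (val _) = ⊥

  leM-refl : ∀ {a} → leM a a
  leM-refl {val a} = LeV-refl
  leM-refl {top} = tt

  leM-trans : ∀ {a b c} → leM a b → leM b c → leM a c
  leM-trans {val a} {val b} {val c} p q = LeV-trans p q
  leM-trans {val a} {_} {top} p q = tt
  leM-trans {top} {top} {top} p q = tt

  leM-top : ∀ a → leM a top
  leM-top (val a) = tt
  leM-top top = tt

  leM⇒≤M : ∀ a b → leM a b → _≤M_ G a b
  leM⇒≤M (val a) (val b) (inj₁ p) = inj₂ (LtV⇒<E a b p)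
  leM⇒≤M (val a) (val b) (inj₂ refl) = inj₁ refl
  leM⇒≤M (val a) top _ = inj₂ tt
  leM⇒≤M top top _ = inj₁ refl

  ≤M⇒leM : ∀ a b → _≤M_ G a b → leM a b
  ≤M⇒leM a .a (inj₁ refl) = leM-refl
  ≤M⇒leM (val a) (val b) (inj₂ p) = inj₁ (<E⇒LtV a b p)
  ≤M⇒leM (val a) top (inj₂ p) = tt

  ltMᵇ-true : ∀ a b → ltMᵇ G a b ≡ true → leM a b
  ltMᵇ-true (val a) top _ = tt
  ltMᵇ-true (val a) (val b) h with cmpE prio a b in e
  ... | LT = inj₁ refl
  ltMᵇ-true (val a) (val b) () | EQ
  ltMᵇ-true (val a) (val b) () | GT

  ltMᵇ-false : ∀ a b → ltMᵇ G a b ≡ false → leM b a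
  ltMᵇ-false top b _ = leM-top b
  ltMᵇ-false (val a) (val b) h with cmpE prio a b in e
  ... | EQ = inj₂ (sym (cmpE-EQ prio a b e))
  ... | GT = inj₁ (GT⇒LtV a b e)
  ltMᵇ-false (val a) (val b) () | LT

  ltMᵇ-true⇒¬leM : ∀ a b → ltMᵇ G a b ≡ true → ¬ leM b a
  ltMᵇ-true⇒¬leM (val a) (val b) h b≤a with cmpE prio a b in e
  ... | LT = LtV-asym e b≤a
  ltMᵇ-true⇒¬leM (val a) (val b) () b≤a | EQ
  ltMᵇ-true⇒¬leM (val a) (val b) () b≤a | GT

  leF : Fft d → Fft d → Set
  leF negInf _ = ⊤
  leF (fin a) negInf = ⊥
  leF (fin a) (fin b) = LeV a b
  leF (fin a) posInf = ⊤
  leF posInf posInf = ⊤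
  leF posInf _ = ⊥

  leF-refl : ∀ {a} → leF a a
  leF-refl {negInf} = tt
  leF-refl {fin a} = LeV-refl
  leF-refl {posInf} = tt

  leF-trans : ∀ {a b c} → leF a b → leF b c → leF a c
  leF-trans {negInf} p q = tt
  leF-trans {fin a} {fin b} {fin c} p q = LeV-trans p q
  leF-trans {fin a} {fin b} {posInf} p q = tt
  leF-trans {fin a} {posInf} {posInf} p q = tt
  leF-trans {posInf} {posInf} {posInf} p q = tt

  leF-posInf : ∀ a → leF a posInf
  leF-posInf negInf = tt
  leF-posInf (fin a) = tt
  leF-posInf posInf = tt

  posInf-leF : ∀ a → leF posInf a → a ≡ posInf
  posInf-leF posInf _ = refl

  leF-negInf : ∀ a → leF a negInf → a ≡ negInf
  leF-negInf negInf _ = refl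

  maxM-sel : ∀ a b → maxM G a b ≡ a ⊎ maxM G a b ≡ b
  maxM-sel top b = inj₁ refl
  maxM-sel (val a) top = inj₂ refl
  maxM-sel (val a) (val b) with cmpE prio a b
  ... | LT = inj₂ refl
  ... | EQ = inj₁ refl
  ... | GT = inj₁ refl

  maxM-ubˡ : ∀ a b → leM a (maxM G a b)
  maxM-ubˡ top b = tt
  maxM-ubˡ (val a) top = tt
  maxM-ubˡ (val a) (val b) with cmpE prio a b in e
  ... | LT = inj₁ e
  ... | EQ = inj₂ refl
  ... | GT = inj₂ refl

  maxM-ubʳ : ∀ a b → leM b (maxM G a b)
  maxM-ubʳ top b = leM-top b
  maxM-ubʳ (val a) top = tt
  maxM-ubʳ (val a) (val b) with cmpE prio a b in e
  ... | LT = inj₂ refl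
  ... | EQ = inj₂ (sym (cmpE-EQ prio a b e))
  ... | GT = inj₁ (GT⇒LtV a b e)

  minM-sel : ∀ a b → minM G a b ≡ a ⊎ minM G a b ≡ b
  minM-sel top b = inj₂ refl
  minM-sel (val a) top = inj₁ refl
  minM-sel (val a) (val b) with cmpE prio a b
  ... | LT = inj₁ refl
  ... | EQ = inj₁ refl
  ... | GT = inj₂ refl

  minM-lbˡ : ∀ a b → leM (minM G a b) a
  minM-lbˡ top b = leM-top _
  minM-lbˡ (val a) top = LeV-refl
  minM-lbˡ (val a) (val b) with cmpE prio a b in e
  ... | LT = inj₂ refl
  ... | EQ = inj₂ refl
  ... | GT = inj₁ (GT⇒LtV a b e)

  minM-lbʳ : ∀ a b → leM (minM G a b) b
  minM-lbʳ top b = leM-refl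
  minM-lbʳ (val a) top = tt
  minM-lbʳ (val a) (val b) with cmpE prio a b in e
  ... | LT = inj₁ e
  ... | EQ = inj₂ (cmpE-EQ prio a b e)
  ... | GT = inj₂ refl

  maxF-sel : ∀ a b → maxF G a b ≡ a ⊎ maxF G a b ≡ b
  maxF-sel negInf b = inj₂ refl
  maxF-sel posInf b = inj₁ refl
  maxF-sel (fin a) negInf = inj₁ refl
  maxF-sel (fin a) posInf = inj₂ refl
  maxF-sel (fin a) (fin b) with cmpE prio a b
  ... | LT = inj₂ refl
  ... | EQ = inj₁ refl
  ... | GT = inj₁ refl

  maxF-ubˡ : ∀ a b → leF a (maxF G a b)
  maxF-ubˡ negInf b = tt
  maxF-ubˡ posInf b = tt
  maxF-ubˡ (fin a) negInf = LeV-refl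
  maxF-ubˡ (fin a) posInf = tt
  maxF-ubˡ (fin a) (fin b) with cmpE prio a b in e
  ... | LT = inj₁ e
  ... | EQ = inj₂ refl
  ... | GT = inj₂ refl

  maxF-ubʳ : ∀ a b → leF b (maxF G a b)
  maxF-ubʳ negInf b = leF-refl
  maxF-ubʳ posInf b = leF-posInf b
  maxF-ubʳ (fin a) negInf = tt
  maxF-ubʳ (fin a) posInf = tt
  maxF-ubʳ (fin a) (fin b) with cmpE prio a b in e
  ... | LT = inj₂ refl
  ... | EQ = inj₂ (sym (cmpE-EQ prio a b e))
  ... | GT = inj₁ (GT⇒LtV a b e)

  minF-sel : ∀ a b → minF G a b ≡ a ⊎ minF G a b ≡ b
  minF-sel negInf b = inj₁ refl
  minF-sel posInf b = inj₂ refl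
  minF-sel (fin a) negInf = inj₂ refl
  minF-sel (fin a) posInf = inj₁ refl
  minF-sel (fin a) (fin b) with cmpE prio a b
  ... | LT = inj₁ refl
  ... | EQ = inj₁ refl
  ... | GT = inj₂ refl

  minF-lbˡ : ∀ a b → leF (minF G a b) a
  minF-lbˡ negInf b = tt
  minF-lbˡ posInf b = leF-posInf b
  minF-lbˡ (fin a) negInf = tt
  minF-lbˡ (fin a) posInf = LeV-refl
  minF-lbˡ (fin a) (fin b) with cmpE prio a b in e
  ... | LT = inj₂ refl
  ... | EQ = inj₂ refl
  ... | GT = inj₁ (GT⇒LtV a b e)

  minF-lbʳ : ∀ a b → leF (minF G a b) b
  minF-lbʳ negInf b = tt
  minF-lbʳ posInf b = leF-refl
  minF-lbʳ (fin a) negInf = tt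
  minF-lbʳ (fin a) posInf = tt
  minF-lbʳ (fin a) (fin b) with cmpE prio a b in e
  ... | LT = inj₁ e
  ... | EQ = inj₂ (cmpE-EQ prio a b e)
  ... | GT = inj₂ refl

  module MaxM = SelectiveFold leM leM-trans (maxM G) maxM-sel maxM-ubˡ maxM-ubʳ
  module MinM = SelectiveFold (λ a b → leM b a) (λ p q → leM-trans q p) (minM G) minM-sel minM-lbˡ minM-lbʳ
  module MaxF = SelectiveFold leF leF-trans (maxF G) maxF-sel maxF-ubˡ maxF-ubʳ
  module MinF = SelectiveFold (λ a b → leF b a) (λ p q → leF-trans q p) (minF G) minF-sel minF-lbˡ minF-lbʳ

  val-injective : ∀ {a b : Vec ℤ d} → val a ≡ val b → a ≡ b
  val-injective refl = refl

  InMPlus⇒zeros-LeV : ∀ η → InMPlus G η → LeV zeros η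
  InMPlus⇒zeros-LeV η (_ , inj₁ refl) = inj₂ refl
  InMPlus⇒zeros-LeV η (nonneg , inj₂ (k , ηk≢0 , above , ev)) = inj₁ (<E⇒LtV zeros η (k , ne , above′ , ev′ , od′))
    where
      ne : lookup zeros k ≢ lookup η k
      ne p = ηk≢0 (trans (sym p) (lookup-replicate k 0ℤ))
      above′ : ∀ j → prio k ℕ.< prio j → lookup zeros j ≡ lookup η j
      above′ j lt = trans (lookup-replicate j 0ℤ) (sym (above j lt))
      ev′ : Even (prio k) → lookup zeros k ℤ.< lookup η k
      ev′ _ rewrite lookup-replicate {n = d} k 0ℤ = ℤP.≤∧≢⇒< (nonneg k) (ηk≢0 ∘ sym)
      od′ : Odd (prio k) → lookup η k ℤ.< lookup zeros k
      od′ o = ⊥-elim (¬Even∧Odd (prio k) ev o)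

  zeros-InMPlus : InMPlus G zeros
  zeros-InMPlus = (λ k → ℤP.≤-reflexive (sym (lookup-replicate k 0ℤ))) , inj₁ refl

  nonneg-InMPlus : ∀ η → (∀ k → 0ℤ ℤ.≤ lookup η k) → LtV zeros η → InMPlus G η
  nonneg-InMPlus η nonneg lt with LtV⇒<E zeros η lt
  ... | k , ne , above , ev , od = nonneg , inj₂ (k , ηk≢0 , above′ , even)
    where
      ηk≢0 : lookup η k ≢ 0ℤ
      ηk≢0 p = ne (trans (lookup-replicate k 0ℤ) (sym p))
      above′ : ∀ j → prio k ℕ.< prio j → lookup η j ≡ 0ℤ
      above′ j l = trans (sym (above j l)) (lookup-replicate j 0ℤ)
      even : Even (prio k)
      even with even-or-odd (prio k)
      ... | inj₁ e = e
      ... | inj₂ o = ⊥-elim (ℤP.<⇒≱ (od o) (subst (ℤ._≤ lookup η k) (sym (lookup-replicate k 0ℤ)) (nonneg k)))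

  lookup-⊕δ-self : ∀ η i → lookup (η ⊕ δ G i) i ≡ lookup η i ℤ.+ 1ℤ
  lookup-⊕δ-self η i rewrite lookup-zipWith ℤ._+_ i η (δ G i) | lookup∘tabulate (λ j → if does (i Fin.≟ j) then 1ℤ else 0ℤ) i
    with i Fin.≟ i
  ... | yes _ = refl
  ... | no i≢i = ⊥-elim (i≢i refl)

  lookup-⊕δ-other : ∀ η i j → i ≢ j → lookup (η ⊕ δ G i) j ≡ lookup η j
  lookup-⊕δ-other η i j i≢j rewrite lookup-zipWith ℤ._+_ j η (δ G i) | lookup∘tabulate (λ j → if does (i Fin.≟ j) then 1ℤ else 0ℤ) j
    with i Fin.≟ j
  ... | yes i≡j = ⊥-elim (i≢j i≡j)
  ... | no _ = ℤP.+-identityʳ _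

  nonneg-⊕δ : ∀ η i → (∀ k → 0ℤ ℤ.≤ lookup η k) → ∀ k → 0ℤ ℤ.≤ lookup (η ⊕ δ G i) k
  nonneg-⊕δ η i nonneg k with i Fin.≟ k
  ... | yes refl rewrite lookup-⊕δ-self η i = ℤP.≤-trans (nonneg i) (ℤP.i≤i+j _ 1ℤ)
  ... | no i≢k rewrite lookup-⊕δ-other η i k i≢k = nonneg k

  prio-injective : ∀ i j → prio i ≡ prio j → i ≡ j
  prio-injective i j e with FinP.<-cmp i j
  ... | tri< lt _ _ = ⊥-elim (ℕP.<⇒≢ (prio-strict i j lt) e)
  ... | tri≈ _ p _ = p
  ... | tri> _ _ gt = ⊥-elim (ℕP.<⇒≢ (prio-strict j i gt) (sym e))

  -- trunc G (val η) v is val (truncAt (pr v) η) by definition.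
  truncAt : Fin d → Vec ℤ d → Vec ℤ d
  truncAt q η = tabulate λ k → if prio q ℕ.≤ᵇ prio k then lookup η k else 0ℤ

  truncAt-≥ : ∀ q η k → prio q ≤ prio k → lookup (truncAt q η) k ≡ lookup η k
  truncAt-≥ q η k le rewrite lookup∘tabulate (λ k → if prio q ℕ.≤ᵇ prio k then lookup η k else 0ℤ) k
    with prio q ℕ.≤ᵇ prio k | ℕP.≤⇒≤ᵇ le
  ... | true | _ = refl

  truncAt-< : ∀ q η k → prio k < prio q → lookup (truncAt q η) k ≡ 0ℤ
  truncAt-< q η k lt rewrite lookup∘tabulate (λ k → if prio q ℕ.≤ᵇ prio k then lookup η k else 0ℤ) k
    with prio q ℕ.≤ᵇ prio k in e
  ... | true = ⊥-elim (ℕP.<⇒≱ lt (ℕP.≤ᵇ⇒≤ _ _ (subst T (sym e) tt)))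
  ... | false = refl

  truncAt-zeros : ∀ q → truncAt q zeros ≡ zeros
  truncAt-zeros q = lookup-ext _ _ λ k → case prio q ℕ.≤? prio k of λ where
    (yes le) → truncAt-≥ q zeros k le
    (no nle) → trans (truncAt-< q zeros k (ℕP.≰⇒> nle)) (sym (lookup-replicate k 0ℤ))

  truncAt-cong-≥ : ∀ q a b → (∀ k → prio q ≤ prio k → lookup a k ≡ lookup b k) → truncAt q a ≡ truncAt q b
  truncAt-cong-≥ q a b h = lookup-ext _ _ λ k → case prio q ℕ.≤? prio k of λ where
    (yes le) → trans (truncAt-≥ q a k le) (trans (h k le) (sym (truncAt-≥ q b k le)))
    (no nle) → trans (truncAt-< q a k (ℕP.≰⇒> nle)) (sym (truncAt-< q b k (ℕP.≰⇒> nle)))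

  truncAt-mono : ∀ q a b → LeV a b → LeV (truncAt q a) (truncAt q b)
  truncAt-mono q a b (inj₂ refl) = inj₂ refl
  truncAt-mono q a b (inj₁ lt) with LtV⇒<E a b lt
  ... | k , ne , above , ev , od with prio q ℕ.≤? prio k
  ...   | yes le = inj₁ (<E⇒LtV _ _ (k , ne′ , above′ , ev′ , od′))
    where
      ne′ : lookup (truncAt q a) k ≢ lookup (truncAt q b) k
      ne′ p = ne (trans (sym (truncAt-≥ q a k le)) (trans p (truncAt-≥ q b k le)))
      above′ : ∀ j → prio k < prio j → lookup (truncAt q a) j ≡ lookup (truncAt q b) j
      above′ j l = trans (truncAt-≥ q a j le′) (trans (above j l) (sym (truncAt-≥ q b j le′)))
        where le′ = ℕP.≤-trans le (ℕP.<⇒≤ l)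
      ev′ : Even (prio k) → lookup (truncAt q a) k ℤ.< lookup (truncAt q b) k
      ev′ e rewrite truncAt-≥ q a k le | truncAt-≥ q b k le = ev e
      od′ : Odd (prio k) → lookup (truncAt q b) k ℤ.< lookup (truncAt q a) k
      od′ o rewrite truncAt-≥ q a k le | truncAt-≥ q b k le = od o
  ...   | no nle = inj₂ (truncAt-cong-≥ q a b λ j le → above j (ℕP.<-≤-trans (ℕP.≰⇒> nle) le))

  truncAt-⊕δ-below : ∀ q i b → prio i < prio q → truncAt q (b ⊕ δ G i) ≡ truncAt q b
  truncAt-⊕δ-below q i b lt = truncAt-cong-≥ q (b ⊕ δ G i) b λ j le →
    lookup-⊕δ-other b i j (λ { refl → ℕP.<⇒≱ lt le })

  truncAt-⊕δ-odd : ∀ q b → Odd (prio q) → LtV (truncAt q (b ⊕ δ G q)) (truncAt q b)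
  truncAt-⊕δ-odd q b o = <E⇒LtV _ _ (q , (λ p → ℤP.<⇒≢ bq<bq+1 (sym p)) , above , (λ e → ⊥-elim (¬Even∧Odd (prio q) e o)) , λ _ → bq<bq+1)
    where
      bq<bq+1 : lookup (truncAt q b) q ℤ.< lookup (truncAt q (b ⊕ δ G q)) q
      bq<bq+1 rewrite truncAt-≥ q b q ℕP.≤-refl | truncAt-≥ q (b ⊕ δ G q) q ℕP.≤-refl | lookup-⊕δ-self b q =
        subst (ℤ._< lookup b q ℤ.+ 1ℤ) (ℤP.+-identityʳ (lookup b q)) (ℤP.+-monoʳ-< (lookup b q) {0ℤ} {1ℤ} (ℤ.+<+ (ℕ.s≤s ℕ.z≤n)))
      above : ∀ j → prio q < prio j → lookup (truncAt q (b ⊕ δ G q)) j ≡ lookup (truncAt q b) j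
      above j l rewrite truncAt-≥ q (b ⊕ δ G q) j (ℕP.<⇒≤ l) | truncAt-≥ q b j (ℕP.<⇒≤ l) =
        lookup-⊕δ-other b q j λ { refl → ℕP.<-irrefl refl l }

  zeros-LtV⇒truncAt≢zeros : ∀ q x → LtV zeros x → lookup x q ≢ 0ℤ → truncAt q x ≢ zeros
  zeros-LtV⇒truncAt≢zeros q x lt xq≢0 tx≡0 with LtV⇒<E zeros x lt
  ... | k , ne , above , _ with prio q ℕ.≤? prio k
  ...   | yes le = ne (sym (trans (sym (truncAt-≥ q x k le)) (cong (λ t → lookup t k) tx≡0)))
  ...   | no nle = xq≢0 (trans (sym (above q (ℕP.≰⇒> nle))) (lookup-replicate q 0ℤ))

  data StretchView (x : Vec ℤ d) : Msr d → Set where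
    unclipped : LeV zeros x → StretchView x (val x)
    clipped : LtV x zeros → StretchView x (val zeros)

  stretch-view : ∀ η v → StretchView (η ⊕ δ G (pr v)) (stretch G (val η) v)
  stretch-view η v with cmpE prio (η ⊕ δ G (pr v)) zeros in e
  ... | LT = clipped e
  ... | EQ = unclipped (inj₂ (sym (cmpE-EQ prio _ _ e)))
  ... | GT = unclipped (inj₁ (GT⇒LtV _ _ e))

  stretch-val : ∀ η v → Σ (Vec ℤ d) λ s → stretch G (val η) v ≡ val s
  stretch-val η v with stretch G (val η) v | stretch-view η v
  ... | _ | unclipped _ = _ , refl
  ... | _ | clipped _ = _ , refl

  bot-leM-stretch : ∀ m v → leM (val zeros) (stretch G m v)
  bot-leM-stretch top v = tt
  bot-leM-stretch (val η) v with stretch G (val η) v | stretch-view η v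
  ... | _ | unclipped p = p
  ... | _ | clipped _ = inj₂ refl

  ⊕δ-leM-stretch : ∀ η v → leM (val (η ⊕ δ G (pr v))) (stretch G (val η) v)
  ⊕δ-leM-stretch η v with stretch G (val η) v | stretch-view η v
  ... | _ | unclipped _ = inj₂ refl
  ... | _ | clipped p = inj₁ p

  stretch-mono : ∀ a b v → leM a b → leM (stretch G a v) (stretch G b v)
  stretch-mono a top v _ = leM-top _
  stretch-mono (val a) (val b) v h with stretch G (val a) v | stretch-view a v | stretch G (val b) v | stretch-view b v
  ... | _ | clipped _ | _ | unclipped q = q
  ... | _ | clipped _ | _ | clipped _ = inj₂ refl
  ... | _ | unclipped p | _ | unclipped q = LeV-shift a b _ h
  ... | _ | unclipped p | _ | clipped q = ⊥-elim (LtV-asym q (LeV-trans p (LeV-shift a b _ h)))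

  stretch-InM : ∀ m v → InM G m → InM G (stretch G m v)
  stretch-InM top v _ = tt
  stretch-InM (val η) v (nonneg , _) with stretch G (val η) v | stretch-view η v
  ... | _ | clipped _ = zeros-InMPlus
  ... | _ | unclipped (inj₂ p) rewrite sym p = zeros-InMPlus
  ... | _ | unclipped (inj₁ p) = nonneg-InMPlus _ (nonneg-⊕δ η (pr v) nonneg) p

  -- Stretching through v raises coordinate p(v), which truncation at v keeps.
  stretch-bot-or-Dplus : ∀ m v → InM G m → stretch G m v ≡ botM G ⊎ ¬ (trunc G (stretch G m v) v ≡ botM G)
  stretch-bot-or-Dplus top v _ = inj₂ (λ ())
  stretch-bot-or-Dplus (val η) v (nonneg , _) with stretch G (val η) v | stretch-view η v
  ... | _ | clipped _ = inj₁ refl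
  ... | _ | unclipped (inj₂ p) rewrite sym p = inj₁ refl
  ... | _ | unclipped (inj₁ p) = inj₂ λ h →
    zeros-LtV⇒truncAt≢zeros (pr v) _ p pv≢0 (val-injective h)
    where
      pv≢0 : lookup (η ⊕ δ G (pr v)) (pr v) ≢ 0ℤ
      pv≢0 rewrite lookup-⊕δ-self η (pr v) = λ p → ℤP.<⇒≢ (ℤP.<-≤-trans (ℤ.+<+ (ℕ.s≤s ℕ.z≤n)) (ℤP.+-monoˡ-≤ 1ℤ (nonneg (pr v)))) (sym p)

  ∈-succIn⁺ : ∀ v (T : Subset G) w → edge v w ≡ true → T w ≡ true → w ∈ succIn G v T
  ∈-succIn⁺ v T w e t = ∈-filterᵇ⁺ _ w (∈-allFin w) (subst (λ b → b ∧ T w ≡ true) (sym e) t)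

  ∈-succIn⁻ : ∀ v (T : Subset G) w → w ∈ succIn G v T → edge v w ≡ true × T w ≡ true
  ∈-succIn⁻ v T w m = ∧-true (proj₂ (∈-filterᵇ⁻ (λ w → edge v w ∧ T w) {allFin n} w m))

  notIn⁺ : ∀ (Q : Subset G) w → Q w ≡ false → notIn G Q w ≡ true
  notIn⁺ Q w h rewrite h = refl

  notIn⁻ : ∀ (Q : Subset G) w → notIn G Q w ≡ true → Q w ≡ false
  notIn⁻ Q w h with Q w
  notIn⁻ Q w () | true
  ... | false = refl

  stretchedSuccs : MeasureFun G → Pos G → Subset G → List (Msr d)
  stretchedSuccs μ v T = map (λ w → stretch G (μ w) v) (succIn G v T)

  data LiftView (μ : MeasureFun G) (v : Pos G) (T : Subset G) : Msr d → Set where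
    lift-max : owner0 v ≡ true → LiftView μ v T (foldr (maxM G) (botM G) (stretchedSuccs μ v T))
    lift-min : owner0 v ≡ false → LiftView μ v T (foldr (minM G) top (stretchedSuccs μ v T))

  lift-view : ∀ μ (S T : Subset G) v → S v ≡ true → LiftView μ v T (lift G μ S T v)
  lift-view μ S T v h with S v
  lift-view μ S T v refl | true with owner0 v in e
  ... | true = lift-max e
  ... | false = lift-min e

  lift-skip : ∀ μ (S T : Subset G) v → S v ≡ false → lift G μ S T v ≡ μ v
  lift-skip μ S T v h rewrite h = refl

  lift-cases : ∀ μ (S T : Subset G) v → S v ≡ true →
    lift G μ S T v ≡ botM G ⊎ lift G μ S T v ≡ top ⊎
    Σ (Pos G) (λ w → w ∈ succIn G v T × lift G μ S T v ≡ stretch G (μ w) v)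
  lift-cases μ S T v h with lift G μ S T v | lift-view μ S T v h
  ... | _ | lift-max _ with MaxM.fold-sel (botM G) (stretchedSuccs μ v T)
  ... | inj₁ p = inj₁ p
  ... | inj₂ (x , m , p) with ∈-map⁻ _ m
  ... | w , mw , refl = inj₂ (inj₂ (w , mw , p))
  lift-cases μ S T v h | _ | lift-min _ with MinM.fold-sel top (stretchedSuccs μ v T)
  ... | inj₁ p = inj₂ (inj₁ p)
  ... | inj₂ (x , m , p) with ∈-map⁻ _ m
  ... | w , mw , refl = inj₂ (inj₂ (w , mw , p))

  lift-V0-ub : ∀ μ S T v → S v ≡ true → owner0 v ≡ true → ∀ w → w ∈ succIn G v T → leM (stretch G (μ w) v) (lift G μ S T v)
  lift-V0-ub μ S T v sv o w mw with lift G μ S T v | lift-view μ S T v sv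
  ... | _ | lift-max _ = MaxM.fold-ub (botM G) (stretchedSuccs μ v T) _ (∈-map⁺ (λ w → stretch G (μ w) v) mw)
  ... | _ | lift-min o′ = ⊥-elim (false≢true (trans (sym o′) o))

  lift-V1-lb : ∀ μ S T v → S v ≡ true → owner0 v ≡ false → ∀ w → w ∈ succIn G v T → leM (lift G μ S T v) (stretch G (μ w) v)
  lift-V1-lb μ S T v sv o w mw with lift G μ S T v | lift-view μ S T v sv
  ... | _ | lift-min _ = MinM.fold-ub top (stretchedSuccs μ v T) _ (∈-map⁺ (λ w → stretch G (μ w) v) mw)
  ... | _ | lift-max o′ = ⊥-elim (false≢true (trans (sym o) o′))

  lift-V1-glb : ∀ μ S T v → S v ≡ true → owner0 v ≡ false → ∀ c → (∀ w → w ∈ succIn G v T → leM c (stretch G (μ w) v)) → leM c (lift G μ S T v)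
  lift-V1-glb μ S T v sv o c h with lift G μ S T v | lift-view μ S T v sv
  ... | _ | lift-min _ = MinM.fold-all (leM c) top (stretchedSuccs μ v T) (leM-top c)
          (λ x mx → let (w , mw , ex) = ∈-map⁻ (λ w → stretch G (μ w) v) mx in subst (leM c) (sym ex) (h w mw))
  ... | _ | lift-max o′ = ⊥-elim (false≢true (trans (sym o) o′))

  data EscView (μ : MeasureFun G) (Q : Subset G) (v : Pos G) : Set where
    esc-V0 : owner0 v ≡ true →
      all (λ w → ltMᵇ G (stretch G (μ w) v) (μ v)) (succIn G v Q) ≡ true → EscView μ Q v
    esc-V1 : owner0 v ≡ false → any (λ _ → true) (succIn G v (notIn G Q)) ≡ true → EscView μ Q v

  esc-view : ∀ μ Q v → esc G μ Q v ≡ true → Q v ≡ true × EscView μ Q v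
  esc-view μ Q v h with Q v
  esc-view μ Q v h | true with owner0 v in e
  ... | true = refl , esc-V0 e h
  ... | false = refl , esc-V1 e h

  data NoEscView (μ : MeasureFun G) (Q : Subset G) (v : Pos G) : Set where
    noEsc-V0 : owner0 v ≡ true →
      all (λ w → ltMᵇ G (stretch G (μ w) v) (μ v)) (succIn G v Q) ≡ false → NoEscView μ Q v
    noEsc-V1 : owner0 v ≡ false → any (λ _ → true) (succIn G v (notIn G Q)) ≡ false → NoEscView μ Q v

  noEsc-view : ∀ μ Q v → Q v ≡ true → esc G μ Q v ≡ false → NoEscView μ Q v
  noEsc-view μ Q v q h with Q v
  noEsc-view μ Q v refl h | true with owner0 v in e
  ... | true = noEsc-V0 e h
  ... | false = noEsc-V1 e h

  esc⊆Q : ∀ μ Q v → esc G μ Q v ≡ true → Q v ≡ true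
  esc⊆Q μ Q v h = proj₁ (esc-view μ Q v h)

  minForfeit : MeasureFun G → Subset G → Fft d
  minForfeit μ Q = foldr (minF G) posInf (map (bef G μ Q) (filterᵇ Q (allFin n)))

  eqFᵇ-sound : ∀ a b → eqFᵇ G a b ≡ true → a ≡ b
  eqFᵇ-sound negInf negInf _ = refl
  eqFᵇ-sound posInf posInf _ = refl
  eqFᵇ-sound (fin a) (fin b) h with ≡-dec ℤ._≟_ a b
  ... | yes p = cong fin p
  eqFᵇ-sound (fin a) (fin b) () | no _
  eqFᵇ-sound negInf (fin _) ()
  eqFᵇ-sound negInf posInf ()
  eqFᵇ-sound (fin _) negInf ()
  eqFᵇ-sound (fin _) posInf ()
  eqFᵇ-sound posInf negInf ()
  eqFᵇ-sound posInf (fin _) ()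

  eqFᵇ-refl : ∀ a → eqFᵇ G a a ≡ true
  eqFᵇ-refl negInf = refl
  eqFᵇ-refl posInf = refl
  eqFᵇ-refl (fin a) with ≡-dec ℤ._≟_ a a
  ... | yes _ = refl
  ... | no p = ⊥-elim (p refl)

  bep-view : ∀ μ Q v → bep G μ Q v ≡ true → esc G μ Q v ≡ true × bef G μ Q v ≡ minForfeit μ Q
  bep-view μ Q v h with ∧-true {esc G μ Q v} h
  ... | e , q = e , eqFᵇ-sound _ _ q

  bep⊆Q : ∀ μ Q v → bep G μ Q v ≡ true → Q v ≡ true
  bep⊆Q μ Q v h = esc⊆Q μ Q v (proj₁ (bep-view μ Q v h))

  bep-outside : ∀ μ Q v → Q v ≡ false → bep G μ Q v ≡ false
  bep-outside μ Q v h with bep G μ Q v in e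
  ... | false = refl
  ... | true = ⊥-elim (false≢true (trans (sym h) (bep⊆Q μ Q v e)))

  bef-noEsc : ∀ μ Q v → esc G μ Q v ≡ false → bef G μ Q v ≡ posInf
  bef-noEsc μ Q v h rewrite h = refl

  succForfeits : MeasureFun G → Pos G → Subset G → List (Fft d)
  succForfeits μ v Q = map (λ w → diffM G (stretch G (μ w) v) (μ v)) (succIn G v (notIn G Q))

  data BefView (μ : MeasureFun G) (Q : Subset G) (v : Pos G) : Fft d → Set where
    bef-max : owner0 v ≡ true → BefView μ Q v (foldr (maxF G) negInf (succForfeits μ v Q))
    bef-min : owner0 v ≡ false → BefView μ Q v (foldr (minF G) posInf (succForfeits μ v Q))

  bef-view : ∀ μ Q v → esc G μ Q v ≡ true → BefView μ Q v (bef G μ Q v)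
  bef-view μ Q v h with esc G μ Q v
  bef-view μ Q v refl | true with owner0 v in e
  ... | true = bef-max e
  ... | false = bef-min e

  esc⇒bep-posInf : ∀ μ Q u → esc G μ Q u ≡ true → minForfeit μ Q ≡ posInf → any (bep G μ Q) (allFin n) ≡ true
  esc⇒bep-posInf μ Q u h mp = any-intro (bep G μ Q) (allFin n) u (∈-allFin u) bu
    where
      le : leF (minForfeit μ Q) (bef G μ Q u)
      le = MinF.fold-ub posInf _ (bef G μ Q u)
             (∈-map⁺ (bef G μ Q) (∈-filterᵇ⁺ Q u (∈-allFin u) (esc⊆Q μ Q u h)))
      bp : bef G μ Q u ≡ posInf
      bp = posInf-leF (bef G μ Q u) (subst (λ z → leF z (bef G μ Q u)) mp le)
      bu : bep G μ Q u ≡ true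
      bu = trans (cong₂ (λ a b → a ∧ eqFᵇ G b (minForfeit μ Q)) h bp) (cong (eqFᵇ G posInf) mp)

  -- The minimal forfeit over Q is attained by an escaping position unless it is posInf, and
  -- then every escaping position attains it.
  esc⇒bep : ∀ μ Q u → esc G μ Q u ≡ true → any (bep G μ Q) (allFin n) ≡ true
  esc⇒bep μ Q u h with MinF.fold-sel posInf (map (bef G μ Q) (filterᵇ Q (allFin n)))
  ... | inj₁ p = esc⇒bep-posInf μ Q u h p
  ... | inj₂ (x , m , p) with ∈-map⁻ (bef G μ Q) m
  ... | u′ , mu′ , refl = by-esc (esc G μ Q u′) refl
    where
      by-esc : (b : Bool) → esc G μ Q u′ ≡ b → any (bep G μ Q) (allFin n) ≡ true
      by-esc true e = any-intro (bep G μ Q) (allFin n) u′ (∈-allFin u′)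
                 (trans (cong (λ b → b ∧ eqFᵇ G (bef G μ Q u′) (minForfeit μ Q)) e)
                        (subst (λ z → eqFᵇ G (bef G μ Q u′) z ≡ true) (sym p) (eqFᵇ-refl (bef G μ Q u′))))
      by-esc false e = esc⇒bep-posInf μ Q u h (trans p (bef-noEsc μ Q u′ e))

  bef-V0 : ∀ μ Q v → esc G μ Q v ≡ true → owner0 v ≡ true → bef G μ Q v ≡ foldr (maxF G) negInf (succForfeits μ v Q)
  bef-V0 μ Q v ev o with bef G μ Q v | bef-view μ Q v ev
  ... | _ | bef-max _ = refl
  ... | _ | bef-min o′ = ⊥-elim (false≢true (trans (sym o′) o))

  bef-V1 : ∀ μ Q v → esc G μ Q v ≡ true → owner0 v ≡ false → bef G μ Q v ≡ foldr (minF G) posInf (succForfeits μ v Q)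
  bef-V1 μ Q v ev o with bef G μ Q v | bef-view μ Q v ev
  ... | _ | bef-min _ = refl
  ... | _ | bef-max o′ = ⊥-elim (false≢true (trans (sym o) o′))

  nextQ : MeasureFun G → Subset G → Subset G
  nextQ μ Q v = Q v ∧ not (bep G μ Q v)

  nextμ : MeasureFun G → Subset G → MeasureFun G
  nextμ μ Q = lift G μ (bep G μ Q) (notIn G Q)

  module PrgLoopInduction (Inv : ℕ → MeasureFun G → Subset G → Set) (P : MeasureFun G → Set)
    (step : ∀ k μ Q → Inv (suc k) μ Q → any (bep G μ Q) (allFin n) ≡ true → Inv k (nextμ μ Q) (nextQ μ Q))
    (stop : ∀ k μ Q → Inv (suc k) μ Q → any (bep G μ Q) (allFin n) ≡ false → P (finish G μ Q))
    (stop0 : ∀ μ Q → Inv 0 μ Q → P (finish G μ Q)) where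

    prgLoop-induction : ∀ k μ Q → Inv k μ Q → P (prgLoop G k μ Q)
    prgLoop-induction zero μ Q i = stop0 μ Q i
    prgLoop-induction (suc k) μ Q i with any (bep G μ Q) (allFin n) in e
    ... | true = prgLoop-induction k (nextμ μ Q) (nextQ μ Q) (step k μ Q i e)
    ... | false = stop k μ Q i e

  prgLoop-invariant : (Inv : MeasureFun G → Subset G → Set) (P : MeasureFun G → Set) →
    (∀ μ Q → Inv μ Q → Inv (nextμ μ Q) (nextQ μ Q)) → (∀ μ Q → Inv μ Q → P (finish G μ Q)) →
    ∀ k μ Q → Inv μ Q → P (prgLoop G k μ Q)
  prgLoop-invariant Inv P step stop = PrgLoopInduction.prgLoop-induction (λ _ → Inv) P
    (λ _ μ Q i _ → step μ Q i) (λ _ μ Q i _ → stop μ Q i) stop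

  nextQ-outside : ∀ μ Q v → Q v ≡ false → nextQ μ Q v ≡ false
  nextQ-outside μ Q v h rewrite h = refl

  nextQ-bep : ∀ μ Q v → bep G μ Q v ≡ true → nextQ μ Q v ≡ false
  nextQ-bep μ Q v h rewrite h | bep⊆Q μ Q v h = refl

  nextQ-¬bep : ∀ μ Q v → bep G μ Q v ≡ false → nextQ μ Q v ≡ Q v
  nextQ-¬bep μ Q v h rewrite h with Q v
  ... | true = refl
  ... | false = refl

  nextQ-inside : ∀ μ Q v → nextQ μ Q v ≡ true → Q v ≡ true × bep G μ Q v ≡ false
  nextQ-inside μ Q v h with Q v | bep G μ Q v
  ... | true | false = refl , refl
  nextQ-inside μ Q v () | true | true
  nextQ-inside μ Q v () | false | _

  nextμ-¬bep : ∀ μ Q v → bep G μ Q v ≡ false → nextμ μ Q v ≡ μ v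
  nextμ-¬bep μ Q v h = lift-skip μ (bep G μ Q) (notIn G Q) v h

  nextμ-outside : ∀ μ Q v → Q v ≡ false → nextμ μ Q v ≡ μ v
  nextμ-outside μ Q v h = nextμ-¬bep μ Q v (bep-outside μ Q v h)

  finish-outside : ∀ μ (Q : Subset G) v → Q v ≡ false → finish G μ Q v ≡ μ v
  finish-outside μ Q v h rewrite h = refl

  finish-inside : ∀ μ (Q : Subset G) v → Q v ≡ true → finish G μ Q v ≡ top
  finish-inside μ Q v h rewrite h = refl

  prgLoop-outside : ∀ k μ Q v → Q v ≡ false → prgLoop G k μ Q v ≡ μ v
  prgLoop-outside zero μ Q v h = finish-outside μ Q v h
  prgLoop-outside (suc k) μ Q v h with any (bep G μ Q) (allFin n)
  ... | true = trans (prgLoop-outside k (nextμ μ Q) (nextQ μ Q) v (nextQ-outside μ Q v h)) (nextμ-outside μ Q v h)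
  ... | false = finish-outside μ Q v h

  count : Subset G → ℕ
  count Q = countᵇ Q (allFin n)

  count≤n : ∀ Q → count Q ≤ n
  count≤n Q = subst (count Q ≤_) (length-tabulate {n = n} (λ x → x)) (countᵇ-≤-length Q (allFin n))

  count-pos : ∀ Q v → Q v ≡ true → 1 ≤ count Q
  count-pos Q v h = ℕP.≤-trans (ℕ.s≤s ℕ.z≤n) (countᵇ-strict (λ _ → false) Q (allFin n) v (∈-allFin v) refl h (λ x ()))

  count-nextQ : ∀ μ Q → any (bep G μ Q) (allFin n) ≡ true → count (nextQ μ Q) < count Q
  count-nextQ μ Q h with any-true (bep G μ Q) (allFin n) h
  ... | u , _ , bu = countᵇ-strict (nextQ μ Q) Q (allFin n) u (∈-allFin u) (nextQ-bep μ Q u bu) (bep⊆Q μ Q u bu)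
                       (λ x q → proj₁ (nextQ-inside μ Q x q))

  lift-IsMF : ∀ μ S T → IsMF G μ → IsMF G (lift G μ S T)
  lift-IsMF μ S T im v = by-S (S v) refl
    where
      by-S : ∀ b → S v ≡ b → InM G (lift G μ S T v)
      by-S false e rewrite lift-skip μ S T v e = im v
      by-S true e with lift-cases μ S T v e
      ... | inj₁ p rewrite p = zeros-InMPlus
      ... | inj₂ (inj₁ p) rewrite p = tt
      ... | inj₂ (inj₂ (w , _ , p)) rewrite p = stretch-InM (μ w) v (im w)

  finish-IsMF : ∀ μ Q → IsMF G μ → IsMF G (finish G μ Q)
  finish-IsMF μ Q im v with Q v
  ... | true = tt
  ... | false = im v

  trunc-bot : ∀ v → trunc G (botM G) v ≡ botM G
  trunc-bot v = cong val (truncAt-zeros (pr v))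

  isBotᵇ-true : ∀ m → isBotᵇ G m ≡ true → m ≡ botM G
  isBotᵇ-true (val η) h with ≡-dec ℤ._≟_ η zeros
  ... | yes p = cong val p
  isBotᵇ-true (val η) () | no _
  isBotᵇ-true top ()

  isBotᵇ-false : ∀ m → isBotᵇ G m ≡ false → ¬ (m ≡ botM G)
  isBotᵇ-false (val η) h refl with ≡-dec ℤ._≟_ (zeros {d}) zeros
  isBotᵇ-false (val η) () refl | yes _
  ... | no p = p refl
  isBotᵇ-false top h ()

  DplusB⇒Dplus : ∀ μ v → DplusB G μ v ≡ true → Dplus G μ v
  DplusB⇒Dplus μ v h = isBotᵇ-false _ (lem (isBotᵇ G (trunc G (μ v) v)) h)
    where lem : ∀ b → not b ≡ true → b ≡ false
          lem false _ = refl

  ¬DplusB⇒Dbot : ∀ μ v → DplusB G μ v ≡ false → Dbot G μ v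
  ¬DplusB⇒Dbot μ v h = isBotᵇ-true _ (lem (isBotᵇ G (trunc G (μ v) v)) h)
    where lem : ∀ b → not b ≡ false → b ≡ true
          lem true _ = refl

  Dplus⇒DplusB : ∀ μ v → Dplus G μ v → DplusB G μ v ≡ true
  Dplus⇒DplusB μ v h with DplusB G μ v in e
  ... | true = refl
  ... | false = ⊥-elim (h (¬DplusB⇒Dbot μ v e))

  Dplus-resp : ∀ μ μ′ u → μ′ u ≡ μ u → Dplus G μ u → Dplus G μ′ u
  Dplus-resp μ μ′ u e d h = d (subst (λ z → trunc G z u ≡ botM G) e h)

  top⇒Dplus : ∀ μ v → μ v ≡ top → Dplus G μ v
  top⇒Dplus μ v h p rewrite h with p
  ... | ()

  D0⇒top : ∀ (μ : MeasureFun G) v → D0 G μ v → μ v ≡ top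
  D0⇒top μ v h with μ v
  ... | top = refl
  D0⇒top μ v () | val _

  top⇒D0 : ∀ (μ : MeasureFun G) v → μ v ≡ top → D0 G μ v
  top⇒D0 μ v h rewrite h = refl

  τ-any : Fin n → Fin n
  τ-any u = proj₁ (total u)

  MFBotInv : MeasureFun G → Subset G → Set
  MFBotInv μ Q = IsMF G μ × (∀ v → Q v ≡ false → Dbot G μ v → μ v ≡ botM G)

  MFBotInv-step : ∀ μ Q → MFBotInv μ Q → MFBotInv (nextμ μ Q) (nextQ μ Q)
  MFBotInv-step μ Q (im , mb) = lift-IsMF μ (bep G μ Q) (notIn G Q) im , mb′
    where
      mb′ : ∀ v → nextQ μ Q v ≡ false → Dbot G (nextμ μ Q) v → nextμ μ Q v ≡ botM G
      mb′ v q db = by-bep (bep G μ Q v) refl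
        where
          by-bep : ∀ b → bep G μ Q v ≡ b → nextμ μ Q v ≡ botM G
          by-bep false e = trans (nextμ-¬bep μ Q v e)
            (mb v (trans (sym (nextQ-¬bep μ Q v e)) q) (subst (λ z → trunc G z v ≡ botM G) (nextμ-¬bep μ Q v e) db))
          by-bep true e with lift-cases μ (bep G μ Q) (notIn G Q) v e
          ... | inj₁ p = p
          ... | inj₂ (inj₁ p) = case subst (λ z → trunc G z v ≡ botM G) p db of λ ()
          ... | inj₂ (inj₂ (w , _ , p)) with stretch-bot-or-Dplus (μ w) v (im w)
          ...   | inj₁ b = trans p b
          ...   | inj₂ nb = ⊥-elim (nb (subst (λ z → trunc G z v ≡ botM G) p db))

  MFBotInv-finish : ∀ μ Q → MFBotInv μ Q → IsMF G (finish G μ Q) × MFBot G (finish G μ Q)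
  MFBotInv-finish μ Q (im , mb) = finish-IsMF μ Q im , mb′
    where
      mb′ : MFBot G (finish G μ Q)
      mb′ v db with Q v in e
      ... | false = mb v e db
      ... | true = case db of λ ()

  prg₊-MFBot : ∀ μ → IsMF G μ → MFBot G μ → IsMF G (prg₊ G μ) × MFBot G (prg₊ G μ)
  prg₊-MFBot μ im mb = prgLoop-invariant MFBotInv (λ ν → IsMF G ν × MFBot G ν) MFBotInv-step MFBotInv-finish (suc n) μ (DplusB G μ)
    (im , λ v _ → mb v)

  ProgressAt : MeasureFun G → Fin n → Set
  ProgressAt μ v = (V0 G v → ∀ w → E G v w → _≤M_ G (stretch G (μ w) v) (μ v))
                 × (V1 G v → Σ (Fin n) λ w → E G v w × _≤M_ G (stretch G (μ w) v) (μ v))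

  ProgressAt-top : ∀ μ v → μ v ≡ top → ProgressAt μ v
  ProgressAt-top μ v h = (λ _ w _ → below-top w) , (λ _ → proj₁ (total v) , proj₂ (total v) , below-top _)
    where below-top : ∀ w → _≤M_ G (stretch G (μ w) v) (μ v)
          below-top w = leM⇒≤M _ _ (subst (leM _) (sym h) (leM-top _))

  ProgressAt-resp : ∀ {μ ν} v → (∀ w → μ w ≡ ν w) → ProgressAt μ v → ProgressAt ν v
  ProgressAt-resp {μ} {ν} v μ≗ν (p₀ , p₁) = (λ o w e → resp w (p₀ o w e)) , λ o → let w , e , le = p₁ o in w , e , resp w le
    where resp : ∀ w → _≤M_ G (stretch G (μ w) v) (μ v) → _≤M_ G (stretch G (ν w) v) (ν v)
          resp w = subst₂ (λ a b → _≤M_ G (stretch G a v) b) (μ≗ν w) (μ≗ν v)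

  -- Successors inside Q satisfy the inequality because v escapes, those outside because of the lift.
  bep-lift-unchanged⇒progress : ∀ μ Q v → bep G μ Q v ≡ true → nextμ μ Q v ≡ μ v → ProgressAt μ v
  bep-lift-unchanged⇒progress μ Q v bv unchanged
    with nextμ μ Q v | lift-view μ (bep G μ Q) (notIn G Q) v bv | unchanged | proj₂ (esc-view μ Q v (proj₁ (bep-view μ Q v bv)))
  ... | _ | lift-max o | L | esc-V0 _ a = V0-case , λ o′ → ⊥-elim (false≢true (trans (sym o′) o))
    where
      V0-case : V0 G v → ∀ w → E G v w → _≤M_ G (stretch G (μ w) v) (μ v)
      V0-case _ w ew with Q w in qw
      ... | true = leM⇒≤M _ _ (ltMᵇ-true _ _ (all-true _ _ a w (∈-succIn⁺ v Q w ew qw)))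
      ... | false = leM⇒≤M _ _ (subst (leM _) L (MaxM.fold-ub (botM G) (stretchedSuccs μ v (notIn G Q)) _
                      (∈-map⁺ (λ w → stretch G (μ w) v) (∈-succIn⁺ v (notIn G Q) w ew (notIn⁺ Q w qw)))))
  ... | _ | lift-min o | L | esc-V1 _ _ = (λ o′ → ⊥-elim (false≢true (trans (sym o) o′))) , V1-case
    where
      V1-case : V1 G v → Σ (Fin n) λ w → E G v w × _≤M_ G (stretch G (μ w) v) (μ v)
      V1-case _ with MinM.fold-sel top (stretchedSuccs μ v (notIn G Q))
      ... | inj₁ p = proj₂ (ProgressAt-top μ v (trans (sym L) p)) o
      ... | inj₂ (x , x∈ , p) with ∈-map⁻ (λ w → stretch G (μ w) v) x∈
      ...   | w , w∈ , refl = w , proj₁ (∈-succIn⁻ v _ w w∈) , leM⇒≤M _ _ (subst (leM _) (trans (sym p) L) leM-refl)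
  ... | _ | lift-max o | _ | esc-V1 o′ _ = ⊥-elim (false≢true (trans (sym o′) o))
  ... | _ | lift-min o | _ | esc-V0 o′ _ = ⊥-elim (false≢true (trans (sym o) o′))

  prgLoop-fixpoint-progress : ∀ μ₀ k μ Q → (∀ v → Q v ≡ true → μ v ≡ μ₀ v) → (∀ v → prgLoop G k μ Q v ≡ μ₀ v) →
    ∀ v → Q v ≡ true → ProgressAt μ₀ v
  prgLoop-fixpoint-progress μ₀ zero μ Q agree fixed v qv = ProgressAt-top μ₀ v (trans (sym (fixed v)) (finish-inside μ Q v qv))
  prgLoop-fixpoint-progress μ₀ (suc k) μ Q agree fixed v qv with any (bep G μ Q) (allFin n) in e
  ... | false = ProgressAt-top μ₀ v (trans (sym (fixed v)) (finish-inside μ Q v qv))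
  ... | true with bep G μ Q v in bv
  ...   | false = prgLoop-fixpoint-progress μ₀ k (nextμ μ Q) (nextQ μ Q)
                    (λ u q → let qu , bu = nextQ-inside μ Q u q in trans (nextμ-¬bep μ Q u bu) (agree u qu))
                    fixed v (trans (nextQ-¬bep μ Q v bv) qv)
  ...   | true = ProgressAt-resp v μ≗μ₀ (bep-lift-unchanged⇒progress μ Q v bv (trans lifted (sym (μ≗μ₀ v))))
    where
      fixed′ : ∀ u → nextQ μ Q u ≡ false → nextμ μ Q u ≡ μ₀ u
      fixed′ u qu = trans (sym (prgLoop-outside k (nextμ μ Q) (nextQ μ Q) u qu)) (fixed u)
      μ≗μ₀ : ∀ w → μ w ≡ μ₀ w
      μ≗μ₀ w with Q w in qw
      ... | true = agree w qw
      ... | false = trans (sym (nextμ-outside μ Q w qw)) (fixed′ w (nextQ-outside μ Q w qw))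
      lifted : nextμ μ Q v ≡ μ₀ v
      lifted = fixed′ v (nextQ-bep μ Q v bv)

  prg₊-fixpoint-progress : ∀ μ → (∀ v → prg₊ G μ v ≡ μ v) → ProgressOnDplus G μ
  prg₊-fixpoint-progress μ fp v dp = prgLoop-fixpoint-progress μ (suc n) μ (DplusB G μ) (λ _ _ → refl) fp v (Dplus⇒DplusB μ v dp)

  PathWitness : MeasureFun G → Subset G → Fin n → List (Fin n) → Set
  PathWitness μ Q v π = StartsAt G v π × IsPath G π × All (λ u → Q u ≡ false × Dplus G μ u) π × Unique π × μ v ≡ msr G π

  Witnessed : MeasureFun G → Subset G → Fin n → Set
  Witnessed μ Q v = μ v ≡ top ⊎ Σ (List (Fin n)) (PathWitness μ Q v)

  bot-Witnessed : ∀ μ Q v → μ v ≡ botM G → Witnessed μ Q v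
  bot-Witnessed μ Q v p = inj₂ ([] , tt , tt , [] , [] , p)

  Witnessed-transport : ∀ μ Q μ′ Q′ v → (∀ u → Q u ≡ false → μ′ u ≡ μ u) → (∀ u → Q u ≡ false → Q′ u ≡ false) →
    Q v ≡ false → Witnessed μ Q v → Witnessed μ′ Q′ v
  Witnessed-transport μ Q μ′ Q′ v agree shrink qv (inj₁ t) = inj₁ (trans (agree v qv) t)
  Witnessed-transport μ Q μ′ Q′ v agree shrink qv (inj₂ (π , s , ip , al , un , m)) =
    inj₂ (π , s , ip , LAll.map (λ (qu , du) → shrink _ qu , Dplus-resp μ μ′ _ (agree _ qu) du) al , un , trans (agree v qv) m)

  -- v is still in Q, hence not on the path of its successor w, which lies outside Q.
  PathWitness-cons : ∀ μ Q v w π → bep G μ Q v ≡ true → E G v w → nextμ μ Q v ≡ stretch G (μ w) v →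
    Dplus G (λ _ → stretch G (μ w) v) v → PathWitness μ Q w π → PathWitness (nextμ μ Q) (nextQ μ Q) v (v ∷ π)
  PathWitness-cons μ Q v w π bv ew lifted dv (s , ip , al , un , m) =
    refl , extend π s ip , al′ , un′ , trans lifted (cong (λ z → stretch G z v) m)
    where
      extend : ∀ π → StartsAt G w π → IsPath G π → IsPath G (v ∷ π)
      extend [] _ _ = tt
      extend (x ∷ r) refl ipr = ew , ipr
      al′ : All (λ u → nextQ μ Q u ≡ false × Dplus G (nextμ μ Q) u) (v ∷ π)
      al′ = (nextQ-bep μ Q v bv , Dplus-resp (λ _ → stretch G (μ w) v) (nextμ μ Q) v lifted dv)
          ∷ LAll.map (λ (qu , du) → nextQ-outside μ Q _ qu , Dplus-resp μ (nextμ μ Q) _ (nextμ-outside μ Q _ qu) du) al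
      un′ : Unique (v ∷ π)
      un′ = LAll.map (λ (qu , _) v≡u → false≢true (trans (sym qu) (subst (λ z → Q z ≡ true) v≡u (bep⊆Q μ Q v bv)))) al ∷ un

  SimpleInv : MeasureFun G → Subset G → Set
  SimpleInv μ Q = IsMF G μ × (∀ v → Q v ≡ false → Witnessed μ Q v)

  SimpleInv-step : ∀ μ Q → SimpleInv μ Q → SimpleInv (nextμ μ Q) (nextQ μ Q)
  SimpleInv-step μ Q (im , wit) = lift-IsMF μ (bep G μ Q) (notIn G Q) im , wit′
    where
      wit′ : ∀ v → nextQ μ Q v ≡ false → Witnessed (nextμ μ Q) (nextQ μ Q) v
      wit′ v q = by-bep (bep G μ Q v) refl
        where
          by-bep : ∀ b → bep G μ Q v ≡ b → Witnessed (nextμ μ Q) (nextQ μ Q) v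
          by-bep false e = Witnessed-transport μ Q _ _ v (nextμ-outside μ Q) (nextQ-outside μ Q) qv (wit v qv)
            where qv = trans (sym (nextQ-¬bep μ Q v e)) q
          by-bep true e with lift-cases μ (bep G μ Q) (notIn G Q) v e
          ... | inj₁ p = bot-Witnessed _ _ v p
          ... | inj₂ (inj₁ p) = inj₁ p
          ... | inj₂ (inj₂ (w , w∈ , p)) with ∈-succIn⁻ v _ w w∈
          ...   | ew , nq with wit w (notIn⁻ Q w nq) | stretch-bot-or-Dplus (μ w) v (im w)
          ...     | inj₁ t | _ = inj₁ (trans p (cong (λ z → stretch G z v) t))
          ...     | inj₂ _ | inj₁ b = bot-Witnessed _ _ v (trans p b)
          ...     | inj₂ (π , pw) | inj₂ dv = inj₂ (v ∷ π , PathWitness-cons μ Q v w π e ew p dv pw)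

  SimpleInv-finish : ∀ μ Q → SimpleInv μ Q → IsMF G (finish G μ Q) × SimpleMF G (finish G μ Q)
  SimpleInv-finish μ Q (im , wit) = finish-IsMF μ Q im , simple
    where
      simple : SimpleMF G (finish G μ Q)
      simple v with Q v in qv
      ... | true = inj₁ refl
      ... | false with wit v qv
      ...   | inj₁ t = inj₁ t
      ...   | inj₂ (π , s , ip , al , un , m) =
        inj₂ (π , (s , ip , LAll.map (λ (qu , du) → Dplus-resp μ (finish G μ Q) _ (finish-outside μ Q _ qu) du) al , un) , m)

  prg₊-simple : ∀ μ → IsMF G μ → SimpleMF G μ → IsMF G (prg₊ G μ) × SimpleMF G (prg₊ G μ)
  prg₊-simple μ im sm = prgLoop-invariant SimpleInv (λ ν → IsMF G ν × SimpleMF G ν) SimpleInv-step SimpleInv-finish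
    (suc n) μ (DplusB G μ) (im , initial)
    where
      initial : ∀ v → DplusB G μ v ≡ false → Witnessed μ (DplusB G μ) v
      initial v q with sm v
      ... | inj₁ t = ⊥-elim (false≢true (trans (sym q) (Dplus⇒DplusB μ v (top⇒Dplus μ v t))))
      ... | inj₂ ([] , _ , p) = bot-Witnessed _ _ v p
      ... | inj₂ (x ∷ π , (refl , _ , (dx ∷ _) , _) , _) = ⊥-elim (false≢true (trans (sym q) (Dplus⇒DplusB μ v dx)))

  cmpE-⊖ : ∀ s c b → cmpE prio (s ⊖ b) (c ⊖ b) ≡ cmpE prio s c
  cmpE-⊖ s c b rewrite ⊖≡⊕-neg s b | ⊖≡⊕-neg c b = cmpE-shift prio s c _

  maxM-zeros : ∀ s → LeV zeros s → maxM G (val s) (val zeros) ≡ val s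
  maxM-zeros s h with cmpE prio s zeros in e
  ... | LT = ⊥-elim (LtV-asym e h)
  ... | EQ = refl
  ... | GT = refl

  maxM-maxF-⊖ : ∀ s c b → Σ (Vec ℤ d) λ z → maxM G (val s) (val c) ≡ val z × maxF G (fin (s ⊖ b)) (fin (c ⊖ b)) ≡ fin (z ⊖ b)
  maxM-maxF-⊖ s c b rewrite cmpE-⊖ s c b with cmpE prio s c
  ... | LT = c , refl , refl
  ... | EQ = s , refl , refl
  ... | GT = s , refl , refl

  minM-minF-⊖ : ∀ s c b → Σ (Vec ℤ d) λ z → minM G (val s) (val c) ≡ val z × minF G (fin (s ⊖ b)) (fin (c ⊖ b)) ≡ fin (z ⊖ b)
  minM-minF-⊖ s c b rewrite cmpE-⊖ s c b with cmpE prio s c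
  ... | LT = s , refl , refl
  ... | EQ = s , refl , refl
  ... | GT = c , refl , refl

  module _ (μ : MeasureFun G) (v : Fin n) (b : Vec ℤ d) where

    maxFold-forfeit : ∀ m → m ≡ val b → ∀ ws → (∀ w → w ∈ ws → Σ (Vec ℤ d) λ c → μ w ≡ val c) →
      ws ≡ [] ⊎ Σ (Vec ℤ d) (λ c → foldr (maxM G) (botM G) (map (λ w → stretch G (μ w) v) ws) ≡ val c
          × foldr (maxF G) negInf (map (λ w → diffM G (stretch G (μ w) v) m) ws) ≡ fin (c ⊖ b))
    maxFold-forfeit m mb [] h = inj₁ refl
    maxFold-forfeit .(val b) refl (w ∷ ws) h with h w (here refl)
    ... | a , ea with stretch-val a v | bot-leM-stretch (μ w) v
    ... | s , es | ge rewrite ea | es with maxFold-forfeit (val b) refl ws (λ w′ m′ → h w′ (there m′))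
    ... | inj₁ refl = inj₂ (s , maxM-zeros s ge , refl)
    ... | inj₂ (c , e1 , e2) rewrite e1 | e2 with maxM-maxF-⊖ s c b
    ... | z , z1 , z2 = inj₂ (z , z1 , z2)

    minFold-forfeit : ∀ m → m ≡ val b → ∀ ws → (∀ w → w ∈ ws → Σ (Vec ℤ d) λ c → μ w ≡ val c) →
      ws ≡ [] ⊎ Σ (Vec ℤ d) (λ c → foldr (minM G) top (map (λ w → stretch G (μ w) v) ws) ≡ val c
          × foldr (minF G) posInf (map (λ w → diffM G (stretch G (μ w) v) m) ws) ≡ fin (c ⊖ b))
    minFold-forfeit m mb [] h = inj₁ refl
    minFold-forfeit .(val b) refl (w ∷ ws) h with h w (here refl)
    ... | a , ea with stretch-val a v
    ... | s , es rewrite ea | es with minFold-forfeit (val b) refl ws (λ w′ m′ → h w′ (there m′))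
    ... | inj₁ refl = inj₂ (s , refl , refl)
    ... | inj₂ (c , e1 , e2) rewrite e1 | e2 with minM-minF-⊖ s c b
    ... | z , z1 , z2 = inj₂ (z , z1 , z2)

  LiftForfeit : MeasureFun G → Subset G → Subset G → Fin n → Vec ℤ d → Set
  LiftForfeit μ Q S v b = Σ (Vec ℤ d) (λ c → lift G μ S (notIn G Q) v ≡ val c × bef G μ Q v ≡ fin (c ⊖ b))
                 ⊎ (owner0 v ≡ true × lift G μ S (notIn G Q) v ≡ botM G × bef G μ Q v ≡ negInf)

  lift-forfeit : ∀ μ Q S v b → (∀ w → Q w ≡ false → Σ (Vec ℤ d) λ c → μ w ≡ val c) →
    S v ≡ true → esc G μ Q v ≡ true → μ v ≡ val b → LiftForfeit μ Q S v b
  lift-forfeit μ Q S v b out sv ev mv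
    with lift G μ S (notIn G Q) v | lift-view μ S (notIn G Q) v sv | bef G μ Q v | bef-view μ Q v ev
  ... | _ | lift-max o | _ | bef-max _ with maxFold-forfeit μ v b (μ v) mv (succIn G v (notIn G Q)) out′
    where out′ = λ w mw → out w (notIn⁻ Q w (proj₂ (∈-succIn⁻ v (notIn G Q) w mw)))
  ... | inj₁ p rewrite p = inj₂ (o , refl , refl)
  ... | inj₂ (c , e1 , e2) = inj₁ (c , e1 , e2)
  lift-forfeit μ Q S v b out sv ev mv | _ | lift-min o | _ | bef-min _ with minFold-forfeit μ v b (μ v) mv (succIn G v (notIn G Q)) out′
    where out′ = λ w mw → out w (notIn⁻ Q w (proj₂ (∈-succIn⁻ v (notIn G Q) w mw)))
  ... | inj₂ (c , e1 , e2) = inj₁ (c , e1 , e2)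
  ... | inj₁ p with proj₂ (esc-view μ Q v ev)
  ... | esc-V0 o′ _ = ⊥-elim (false≢true (trans (sym o) o′))
  ... | esc-V1 _ a with any-true (λ _ → true) _ a
  ... | x , mx , _ with subst (x ∈_) p mx
  ... | ()
  lift-forfeit μ Q S v b out sv ev mv | _ | lift-max o | _ | bef-min o′ = ⊥-elim (false≢true (trans (sym o′) o))
  lift-forfeit μ Q S v b out sv ev mv | _ | lift-min o | _ | bef-max o′ = ⊥-elim (false≢true (trans (sym o) o′))

  -- b ≠ ⊥ below the stretch of bw forbids clipping, so adding h to bw adds at least h to the stretch.
  stretch-shift-≥ : ∀ b bw h v → InMPlus G b → b ≢ zeros → leM (val b) (stretch G (val bw) v) →
    Σ (Vec ℤ d) λ s → stretch G (val (bw ⊕ h)) v ≡ val s × LeV (h ⊕ b) s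
  stretch-shift-≥ b bw h v ib nz le with stretch G (val bw) v | stretch-view bw v
  ... | _ | clipped _ = ⊥-elim (nz (LeV-antisym le (InMPlus⇒zeros-LeV b ib)))
  ... | _ | unclipped _ with stretch-val (bw ⊕ h) v | ⊕δ-leM-stretch (bw ⊕ h) v
  ... | s , es | ge rewrite es = s , refl , LeV-trans stp ge
    where
      stp : LeV (h ⊕ b) ((bw ⊕ h) ⊕ δ G (pr v))
      stp = subst (LeV (h ⊕ b)) eq (LeV-add h h b (bw ⊕ δ G (pr v)) LeV-refl le)
        where eq : h ⊕ (bw ⊕ δ G (pr v)) ≡ (bw ⊕ h) ⊕ δ G (pr v)
              eq = trans (sym (⊕-assoc h bw _)) (cong (_⊕ δ G (pr v)) (⊕-comm h bw))

  regress-shift-leM : ∀ b bw g h v → InMPlus G b → b ≢ zeros → leM (val b) (stretch G (val bw) v) → LeV g h →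
    leM (val (b ⊕ g)) (stretch G (val (bw ⊕ h)) v)
  regress-shift-leM b bw g h v ib nz le gh with stretch-shift-≥ b bw h v ib nz le
  ... | s , es , hb rewrite es = LeV-trans (subst (λ z → LeV z (h ⊕ b)) (⊕-comm g b) (LeV-shift g h b gh)) hb

  regress-shift-leF : ∀ b bw h v → InMPlus G b → b ≢ zeros → leM (val b) (stretch G (val bw) v) →
    leF (fin h) (diffM G (stretch G (val (bw ⊕ h)) v) (val b))
  regress-shift-leF b bw h v ib nz le with stretch-shift-≥ b bw h v ib nz le
  ... | s , es , hb rewrite es = subst (λ z → LeV z (s ⊖ b)) (⊕-⊖-cancel h b) (LeV-sub (h ⊕ b) s b hb)

  iterate : (Fin n → Fin n) → Fin n → ℕ → Fin n
  iterate S v zero = v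
  iterate S v (suc k) = S (iterate S v k)

  iterate-+ : ∀ S v a t → iterate S v (a + t) ≡ iterate S (iterate S v a) t
  iterate-+ S v a zero rewrite ℕP.+-identityʳ a = refl
  iterate-+ S v a (suc t) rewrite ℕP.+-suc a t = cong S (iterate-+ S v a t)

  iterate-periodic : ∀ S y L′ → iterate S y (suc L′) ≡ y → ∀ N r → iterate S y (N * suc L′ + r) ≡ iterate S y r
  iterate-periodic S y L′ cyc zero r = refl
  iterate-periodic S y L′ cyc (suc N) r = begin
    iterate S y (suc L′ + N * suc L′ + r)            ≡⟨ cong (iterate S y) (ℕP.+-assoc (suc L′) (N * suc L′) r) ⟩
    iterate S y (suc L′ + (N * suc L′ + r))          ≡⟨ iterate-+ S y (suc L′) (N * suc L′ + r) ⟩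
    iterate S (iterate S y (suc L′)) (N * suc L′ + r) ≡⟨ cong (λ z → iterate S z (N * suc L′ + r)) cyc ⟩
    iterate S y (N * suc L′ + r)                     ≡⟨ iterate-periodic S y L′ cyc N r ⟩
    iterate S y r                                    ∎
    where open ≡-Reasoning

  iterate-cycle : ∀ S v → Σ ℕ λ a → Σ ℕ λ L′ → iterate S (iterate S v a) (suc L′) ≡ iterate S v a
  iterate-cycle S v with FinP.pigeonhole (ℕP.n<1+n n) (λ i → iterate S v (Fin.toℕ i))
  ... | i , j , i<j , e with ℕP.m≤n⇒∃[o]m+o≡n i<j
  ...   | L′ , i+1+L′≡j = Fin.toℕ i , L′ , trans (sym (iterate-+ S v (Fin.toℕ i) (suc L′)))
          (trans (cong (iterate S v) (trans (ℕP.+-suc (Fin.toℕ i) L′) i+1+L′≡j)) (sym e))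

  EvenPriority-suffix : ∀ (x z : ℕ → Fin n) a → (∀ t → x (a + t) ≡ z t) → EvenPriority G z → EvenPriority G x
  EvenPriority-suffix x z a shift (q , ev , often , (N , bounded)) = q , ev , often′ , (a + N , bounded′)
    where
      often′ : ∀ N′ → Σ ℕ λ m → N′ ≤ m × pr (x m) ≡ q
      often′ N′ with often N′
      ... | m , le , e = a + m , ℕP.≤-trans le (ℕP.m≤n+m m a) , trans (cong pr (shift m)) e
      bounded′ : ∀ m → a + N ≤ m → prio (pr (x m)) ℕ.≤ prio q
      bounded′ m le with ℕP.m≤n⇒∃[o]m+o≡n (ℕP.≤-trans (ℕP.m≤m+n a N) le)
      ... | t , refl = subst (λ z → prio (pr z) ℕ.≤ prio q) (sym (shift t)) (bounded t (ℕP.+-cancelˡ-≤ a N t le))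

  module RegressCycle (S : Fin n → Fin n) (y : Fin n) (L′ : ℕ) (cyc : iterate S y (suc L′) ≡ y) (β : Fin n → Vec ℤ d)
    (regress : ∀ t → LeV (β (iterate S y t)) (β (iterate S y (suc t)) ⊕ δ G (pr (iterate S y t)))) where

    L : ℕ
    L = suc L′

    reduce : ∀ B t → t ≤ B → Σ ℕ λ r → r ≤ L′ × iterate S y t ≡ iterate S y r
    reduce B t le with t ℕ.≤? L′
    ... | yes p = t , p , refl
    reduce zero t le | no np = ⊥-elim (np (ℕP.≤-trans le ℕ.z≤n))
    reduce (suc B) t le | no np with ℕP.m≤n⇒∃[o]m+o≡n (ℕP.≰⇒> np)
    ... | t′ , refl with reduce B t′ (ℕP.≤-pred (ℕP.≤-trans (ℕP.+-monoˡ-≤ t′ (ℕ.s≤s (ℕ.z≤n {L′}))) le))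
    ...   | r , r≤L′ , e = r , r≤L′ , trans (iterate-+ S y L t′) (trans (cong (λ z → iterate S z t′) cyc) e)

    top-position : Σ ℕ λ r → r ≤ L′ × (∀ s → s ≤ L′ → prio (pr (iterate S y s)) ≤ prio (pr (iterate S y r)))
    top-position = argmax≤ (λ s → prio (pr (iterate S y s))) L′

    r* : ℕ
    r* = proj₁ top-position

    q : Fin d
    q = pr (iterate S y r*)

    bound : ∀ s → s ≤ L′ → prio (pr (iterate S y s)) ≤ prio q
    bound = proj₂ (proj₂ top-position)

    -- Truncated at an odd q, β never increases along the cycle and strictly decreases at r*.
    module _ (oq : Odd (prio q)) where
      truncated-descent : ∀ t → t ≤ L → LeV (truncAt q (β y)) (truncAt q (β (iterate S y t)))
                                    × (r* < t → LtV (truncAt q (β y)) (truncAt q (β (iterate S y t))))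
      truncated-descent zero _ = LeV-refl , λ ()
      truncated-descent (suc t) le with truncated-descent t (ℕP.<⇒≤ le)
      ... | ih , ih-strict with truncAt-mono q _ _ (regress t) | pr (iterate S y t) Fin.≟ q
      ...   | step | yes p≡q = LeV-trans ih (inj₁ strict) , λ _ → LeV-LtV-trans ih strict
        where
          strict : LtV (truncAt q (β (iterate S y t))) (truncAt q (β (iterate S y (suc t))))
          strict = LeV-LtV-trans step (subst (λ i → LtV (truncAt q (β (iterate S y (suc t)) ⊕ δ G i)) (truncAt q (β (iterate S y (suc t)))))
                     (sym p≡q) (truncAt-⊕δ-odd q (β (iterate S y (suc t))) oq))
      ...   | step | no p≢q = LeV-trans ih step′ , strict
        where
          p<q : prio (pr (iterate S y t)) < prio q
          p<q with ℕP.m≤n⇒m<n∨m≡n (bound t (ℕP.≤-pred le))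
          ... | inj₁ l = l
          ... | inj₂ e = ⊥-elim (p≢q (prio-injective _ _ e))
          step′ : LeV (truncAt q (β (iterate S y t))) (truncAt q (β (iterate S y (suc t))))
          step′ = subst (LeV _) (truncAt-⊕δ-below q (pr (iterate S y t)) (β (iterate S y (suc t))) p<q) step
          strict : r* < suc t → LtV (truncAt q (β y)) (truncAt q (β (iterate S y (suc t))))
          strict lt with ℕP.m≤n⇒m<n∨m≡n (ℕP.≤-pred lt)
          ... | inj₁ l = LtV-LeV-trans (ih-strict l) step′
          ... | inj₂ refl = ⊥-elim (p≢q refl)

    max-priority-even : Even (prio q)
    max-priority-even with even-or-odd (prio q)
    ... | inj₁ e = e
    ... | inj₂ o with truncated-descent o L ℕP.≤-refl
    ...   | _ , strict = ⊥-elim (LtV-irrefl _ (subst (λ z → LtV (truncAt q (β y)) (truncAt q (β z))) cyc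
                            (strict (ℕ.s≤s (proj₁ (proj₂ top-position))))))

    cycle-EvenPriority : EvenPriority G (iterate S y)
    cycle-EvenPriority = q , max-priority-even , often , (0 , bounded)
      where
        often : ∀ N → Σ ℕ λ m → N ≤ m × pr (iterate S y m) ≡ q
        often N = N * L + r* , ℕP.≤-trans (ℕP.m≤m*n N L) (ℕP.m≤m+n (N * L) r*) , cong pr (iterate-periodic S y L′ cyc N r*)
        bounded : ∀ m → 0 ≤ m → prio (pr (iterate S y m)) ≤ prio q
        bounded m _ with reduce m m ℕP.≤-refl
        ... | r , r≤L′ , e = subst (λ z → prio (pr z) ≤ prio q) (sym e) (bound r r≤L′)

  module QuasiDominion (μ₀ : MeasureFun G) (im₀ : IsMF G μ₀) (qd : QDMeasure G μ₀) where

    regress : Regress G μ₀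
    regress = proj₁ qd

    σ₀ : Pos G → Pos G
    σ₀ = proj₁ (proj₂ qd)

    σ₀-valid : ∀ v → D0 G μ₀ v → V0 G v → E G v (σ₀ v)
    σ₀-valid = proj₁ (proj₂ (proj₂ qd))

    σ₀-wins : ∀ (τ : Pos G → Pos G) → (∀ v → D0 G μ₀ v → V1 G v → E G v (τ v)) →
      ∀ v → D0 G μ₀ v → (∀ (k : ℕ) → D0 G μ₀ (play G σ₀ τ v k)) × EvenPriority G (play G σ₀ τ v)
    σ₀-wins = proj₂ (proj₂ (proj₂ qd))

    Q₀ : Subset G
    Q₀ = DplusB G μ₀

    dominion-σ₀-top : ∀ v → μ₀ v ≡ top → owner0 v ≡ true → μ₀ (σ₀ v) ≡ top
    dominion-σ₀-top v t o = D0⇒top μ₀ _ (subst (D0 G μ₀) eq (proj₁ (σ₀-wins τ-any (λ u _ _ → proj₂ (total u)) v (top⇒D0 μ₀ v t)) 1))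
      where eq : play G σ₀ τ-any v 1 ≡ σ₀ v
            eq = if-true (owner0 v) _ _ o

    dominion-σ₀-edge : ∀ v → μ₀ v ≡ top → owner0 v ≡ true → edge v (σ₀ v) ≡ true
    dominion-σ₀-edge v t o = σ₀-valid v (top⇒D0 μ₀ v t) o

    -- Against the opponent strategy moving from v to w, the play stays in D₀ only if μ₀ w = ⊤.
    dominion-V1-top : ∀ v w → μ₀ v ≡ top → owner0 v ≡ false → edge v w ≡ true → μ₀ w ≡ top
    dominion-V1-top v w t o ew = D0⇒top μ₀ _ (subst (D0 G μ₀) eq (proj₁ (σ₀-wins τ τv v (top⇒D0 μ₀ v t)) 1))
      where
        τ : Fin n → Fin n
        τ u with u Fin.≟ v
        ... | yes _ = w
        ... | no _ = proj₁ (total u)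
        τv : ∀ u → D0 G μ₀ u → V1 G u → E G u (τ u)
        τv u _ _ with u Fin.≟ v
        ... | yes refl = ew
        ... | no _ = proj₂ (total u)
        τvv : τ v ≡ w
        τvv with v Fin.≟ v
        ... | yes _ = refl
        ... | no p = ⊥-elim (p refl)
        eq : play G σ₀ τ v 1 ≡ w
        eq = trans (if-false (owner0 v) _ _ o) τvv

    outside-Q₀-val : ∀ v → Q₀ v ≡ false → Σ (Vec ℤ d) λ b → μ₀ v ≡ val b
    outside-Q₀-val v q with μ₀ v | ¬DplusB⇒Dbot μ₀ v q
    ... | val b | _ = b , refl
    ... | top | ()

    Q₀-nonzero : ∀ v b → Q₀ v ≡ true → μ₀ v ≡ val b → b ≢ zeros
    Q₀-nonzero v b q e refl = DplusB⇒Dplus μ₀ v q (trans (cong (λ z → trunc G z v) e) (trunc-bot v))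

    InMPlus-μ₀ : ∀ v b → μ₀ v ≡ val b → InMPlus G b
    InMPlus-μ₀ v b e = subst (InM G) e (im₀ v)

    regress-V0 : ∀ v → Q₀ v ≡ true → μ₀ v ≢ top → owner0 v ≡ true → Σ (Fin n) λ w → edge v w ≡ true × leM (μ₀ v) (stretch G (μ₀ w) v)
    regress-V0 v q nt o with proj₁ (regress v (DplusB⇒Dplus μ₀ v q) (λ d → nt (D0⇒top μ₀ v d))) o
    ... | w , ew , le = w , ew , ≤M⇒leM _ _ le

    regress-V1 : ∀ v → Q₀ v ≡ true → μ₀ v ≢ top → owner0 v ≡ false → ∀ w → edge v w ≡ true → leM (μ₀ v) (stretch G (μ₀ w) v)
    regress-V1 v q nt o w ew = ≤M⇒leM _ _ (proj₂ (regress v (DplusB⇒Dplus μ₀ v q) (λ d → nt (D0⇒top μ₀ v d))) o w ew)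

    -- What is known of a position v of Q₀ once it has left Q: its value c dominates μ₀ v, it
    -- satisfies the regress inequality towards the positions outside Q, and (for V1) it exceeds
    -- μ₀ v by at most the current level.
    Lifted : Fft d → MeasureFun G → Subset G → Fin n → Set
    Lifted lv μ Q v = Σ (Vec ℤ d) λ c → μ v ≡ val c × leM (μ₀ v) (val c)
      × (owner0 v ≡ true → Dplus G μ v → Σ (Fin n) λ w → E G v w × Q w ≡ false × leM (μ v) (stretch G (μ w) v))
      × (owner0 v ≡ false → (∀ w → E G v w → Q w ≡ false → leM (μ v) (stretch G (μ w) v))
                          × (∀ b → μ₀ v ≡ val b → Σ (Vec ℤ d) λ g → c ≡ b ⊕ g × leF (fin g) lv))

    -- The level is the forfeit of the previous round; forfeits of the remaining positions never
    -- drop below it.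

    record Invariant (k : ℕ) (μ : MeasureFun G) (Q : Subset G) : Set where
      field
        level : Fft d
        isMF : IsMF G μ
        inside : ∀ v → Q v ≡ true → μ v ≡ μ₀ v × Q₀ v ≡ true
        outside-Q₀ : ∀ v → Q₀ v ≡ false → μ v ≡ μ₀ v × Q v ≡ false
        tops-inside : ∀ v → μ₀ v ≡ top → Q v ≡ true
        lifted : ∀ v → Q₀ v ≡ true → Q v ≡ false → Lifted level μ Q v
        level≤bef : ∀ u → Q u ≡ true → leF level (bef G μ Q u)
        count≤fuel : count Q ≤ k

    outside-val : ∀ {k μ Q} → Invariant k μ Q → ∀ w → Q w ≡ false → Σ (Vec ℤ d) λ c → μ w ≡ val c
    outside-val I w qw with Q₀ w in q0
    ... | true with Invariant.lifted I w q0 qw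
    ...   | c , e , _ = c , e
    outside-val I w qw | false with outside-Q₀-val w q0
    ... | b , e = b , trans (proj₁ (Invariant.outside-Q₀ I w q0)) e

    -- Player 0 keeps a ⊤ position inside Q by the dominion strategy, so it never escapes.
    esc⇒¬top : ∀ μ Q → (∀ v → Q v ≡ true → μ v ≡ μ₀ v × Q₀ v ≡ true) → (∀ v → μ₀ v ≡ top → Q v ≡ true) →
      ∀ v → esc G μ Q v ≡ true → μ₀ v ≢ top
    esc⇒¬top μ Q inside tops-inside v ev t with esc-view μ Q v ev
    ... | qv , esc-V0 o a = false≢true (sym (trans (sym lt) (cong₂ (ltMᵇ G) (cong (λ z → stretch G z v) e1) e2)))
      where
        w = σ₀ v
        qw : Q w ≡ true
        qw = tops-inside w (dominion-σ₀-top v t o)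
        lt : ltMᵇ G (stretch G (μ w) v) (μ v) ≡ true
        lt = all-true _ _ a w (∈-succIn⁺ v Q w (dominion-σ₀-edge v t o) qw)
        e1 : μ w ≡ top
        e1 = trans (proj₁ (inside w qw)) (dominion-σ₀-top v t o)
        e2 : μ v ≡ top
        e2 = trans (proj₁ (inside v qv)) t
    ... | qv , esc-V1 o a with any-true (λ _ → true) _ a
    ... | w , mw , _ with ∈-succIn⁻ v (notIn G Q) w mw
    ... | ew , nq = false≢true (trans (sym (notIn⁻ Q w nq)) (tops-inside w (dominion-V1-top v w t o ew)))

    module Step (k : ℕ) (μ : MeasureFun G) (Q : Subset G) (I : Invariant (suc k) μ Q)
                 (some-bep : any (bep G μ Q) (allFin n) ≡ true) where
      open Invariant I

      m : Fft d
      m = minForfeit μ Q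

      μ′ : MeasureFun G
      μ′ = nextμ μ Q

      Q′ : Subset G
      Q′ = nextQ μ Q

      outside-inflated : ∀ w → Q w ≡ false → leM (μ₀ w) (μ w)
      outside-inflated w qw with Q₀ w in q0
      ... | true with lifted w q0 qw
      ... | c , e , le , _ = subst (leM (μ₀ w)) (sym e) le
      outside-inflated w qw | false = subst (leM (μ₀ w)) (sym (proj₁ (outside-Q₀ w q0))) leM-refl

      esc-val : ∀ v → esc G μ Q v ≡ true → Σ (Vec ℤ d) λ b → μ v ≡ val b × μ₀ v ≡ val b
      esc-val v ev with μ₀ v in e0 | esc⇒¬top μ Q inside tops-inside v ev
      ... | val b | _ = b , trans (proj₁ (inside v (esc⊆Q μ Q v ev))) e0 , refl
      ... | top | nt = ⊥-elim (nt refl)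

      -- A best escape position is lifted by exactly the minimal forfeit m, unless it is a V0
      -- position without successor outside Q: then it drops to ⊥ and m is negInf.
      BepLift : Fin n → Vec ℤ d → Set
      BepLift v b = Σ (Vec ℤ d) (λ c → μ′ v ≡ val c × m ≡ fin (c ⊖ b))
                ⊎ (owner0 v ≡ true × μ′ v ≡ botM G × m ≡ negInf)

      bep-lift : ∀ v → bep G μ Q v ≡ true → Σ (Vec ℤ d) λ b → μ v ≡ val b × μ₀ v ≡ val b × BepLift v b
      bep-lift v bv with bep-view μ Q v bv
      ... | ev , bm with esc-val v ev
      ... | b , e1 , e2 with lift-forfeit μ Q (bep G μ Q) v b (outside-val I) bv ev e1
      ... | inj₁ (c , l , bf) = b , e1 , e2 , inj₁ (c , l , trans (sym bm) bf)
      ... | inj₂ (o , l , bf) = b , e1 , e2 , inj₂ (o , l , trans (sym bm) bf)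

      level≤m : leF level m
      level≤m = MinF.fold-all (leF level) posInf _ (leF-posInf level)
        (λ x mx → let (u , mu , ex) = ∈-map⁻ (bef G μ Q) mx in
                  subst (leF level) (sym ex) (level≤bef u (proj₂ (∈-filterᵇ⁻ Q {allFin n} u mu))))

      m≤bef : ∀ u → Q u ≡ true → leF m (bef G μ Q u)
      m≤bef u qu = MinF.fold-ub posInf _ (bef G μ Q u) (∈-map⁺ (bef G μ Q) (∈-filterᵇ⁺ Q u (∈-allFin u) qu))

      bep-lifted-by : ∀ w h → bep G μ Q w ≡ true → m ≡ fin h →
        Σ (Vec ℤ d) λ bw → μ w ≡ val bw × μ₀ w ≡ val bw × μ′ w ≡ val (bw ⊕ h)
      bep-lifted-by w h bw mh with bep-lift w bw
      ... | b , e1 , e2 , inj₁ (c , l , mc) with trans (sym mh) mc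
      ... | refl = b , e1 , e2 , trans l (cong val (sym (⊕-⊖-cancelˡ c b)))
      bep-lifted-by w h bw mh | b , e1 , e2 , inj₂ (_ , _ , mn) with trans (sym mh) mn
      ... | ()

      inside′ : ∀ v → Q′ v ≡ true → μ′ v ≡ μ₀ v × Q₀ v ≡ true
      inside′ v q with nextQ-inside μ Q v q
      ... | qv , bv = trans (nextμ-¬bep μ Q v bv) (proj₁ (inside v qv)) , proj₂ (inside v qv)

      outside-Q₀′ : ∀ v → Q₀ v ≡ false → μ′ v ≡ μ₀ v × Q′ v ≡ false
      outside-Q₀′ v q with outside-Q₀ v q
      ... | e , qv = trans (nextμ-outside μ Q v qv) e , nextQ-outside μ Q v qv

      tops′ : ∀ v → μ₀ v ≡ top → Q′ v ≡ true
      tops′ v t = by-bep (bep G μ Q v) refl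
        where
          by-bep : ∀ b → bep G μ Q v ≡ b → Q′ v ≡ true
          by-bep true bv = ⊥-elim (esc⇒¬top μ Q inside tops-inside v (proj₁ (bep-view μ Q v bv)) t)
          by-bep false bv = trans (nextQ-¬bep μ Q v bv) (tops-inside v t)

      count≤fuel′ : count Q′ ≤ k
      count≤fuel′ = ℕP.≤-pred (ℕP.≤-trans (count-nextQ μ Q some-bep) count≤fuel)

      Q′-outside : ∀ w → Q w ≡ false → Q′ w ≡ false
      Q′-outside = nextQ-outside μ Q

      μ′-outside : ∀ w → Q w ≡ false → μ′ w ≡ μ w
      μ′-outside = nextμ-outside μ Q

      removed⇒bep : ∀ w → Q w ≡ true → Q′ w ≡ false → bep G μ Q w ≡ true
      removed⇒bep w qw q′w = by-bep (bep G μ Q w) refl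
        where
          by-bep : ∀ b → bep G μ Q w ≡ b → bep G μ Q w ≡ true
          by-bep true e = e
          by-bep false e = ⊥-elim (false≢true (trans (sym q′w) (trans (nextQ-¬bep μ Q w e) qw)))

      μ′-inside : ∀ w → Q′ w ≡ true → μ′ w ≡ μ w
      μ′-inside w q = nextμ-¬bep μ Q w (proj₂ (nextQ-inside μ Q w q))

      V1-esc : ∀ u w → Q u ≡ true → owner0 u ≡ false → w ∈ succIn G u (notIn G Q) → esc G μ Q u ≡ true
      V1-esc u w qu o mw rewrite qu | o = any-intro (λ _ → true) _ w mw refl

      m-finite : ∀ g → leF (fin g) m → Σ (Vec ℤ d) λ h → m ≡ fin h × LeV g h
      m-finite g le with any-true (bep G μ Q) (allFin n) some-bep
      ... | w , _ , bw with bep-lift w bw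
      ... | _ , _ , _ , inj₁ (c , _ , mc) rewrite mc = _ , refl , le
      ... | _ , _ , _ , inj₂ (_ , _ , mn) rewrite mn = ⊥-elim le

      liftedValue : ∀ {v b} → BepLift v b → Vec ℤ d
      liftedValue (inj₁ (c , _ , _)) = c
      liftedValue (inj₂ _) = zeros

      liftedValue-eq : ∀ {v b} (i : BepLift v b) → μ′ v ≡ val (liftedValue i)
      liftedValue-eq (inj₁ (c , l , _)) = l
      liftedValue-eq (inj₂ (_ , l , _)) = l

      -- A V1 position lifted earlier stays below the stretch of a successor removed now: its lift
      -- exceeded μ₀ by at most the earlier level, which is at most m.
      kept-V1-removed-succ : ∀ v w c → Q₀ v ≡ true → Q v ≡ false → μ v ≡ val c → owner0 v ≡ false → E G v w →
        (∀ b → μ₀ v ≡ val b → Σ (Vec ℤ d) λ g → c ≡ b ⊕ g × leF (fin g) level) →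
        Q w ≡ true → Q′ w ≡ false → leM (μ′ v) (stretch G (μ′ w) v)
      kept-V1-removed-succ v w c q₀v qv μv o ew growth qw q′w = by-top (μ₀ v) refl
        where
          by-top : ∀ x → μ₀ v ≡ x → leM (μ′ v) (stretch G (μ′ w) v)
          by-top top μ₀v = ⊥-elim (false≢true (trans (sym qv) (tops-inside v μ₀v)))
          by-top (val b) μ₀v with growth b μ₀v
          ... | g , c≡b⊕g , g≤level with m-finite g (leF-trans g≤level level≤m)
          ...   | h , m≡h , g≤h with bep-lifted-by w h (removed⇒bep w qw q′w) m≡h
          ...     | bw , _ , μ₀w , μ′w = subst₂ (λ a z → leM a (stretch G z v))
                      (sym (trans (μ′-outside v qv) (trans μv (cong val c≡b⊕g)))) (sym μ′w)
                      (regress-shift-leM b bw g h v (InMPlus-μ₀ v b μ₀v) (Q₀-nonzero v b q₀v μ₀v) regress-w g≤h)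
            where
              regress-w : leM (val b) (stretch G (val bw) v)
              regress-w = subst₂ (λ a z → leM a (stretch G z v)) μ₀v μ₀w (regress-V1 v q₀v (λ t → case trans (sym μ₀v) t of λ ()) o w ew)

      Lifted-kept : ∀ v → Q₀ v ≡ true → Q v ≡ false → Lifted m μ′ Q′ v
      Lifted-kept v q₀v qv with lifted v q₀v qv
      ... | c , μv , μ₀≤c , witness₀ , regress₁ = c , trans μ′v μv , μ₀≤c , witness₀′ , regress₁′
        where
          μ′v : μ′ v ≡ μ v
          μ′v = μ′-outside v qv
          witness₀′ : owner0 v ≡ true → Dplus G μ′ v → Σ (Fin n) λ w → E G v w × Q′ w ≡ false × leM (μ′ v) (stretch G (μ′ w) v)
          witness₀′ o dp with witness₀ o (Dplus-resp μ′ μ v (sym μ′v) dp)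
          ... | w , ew , qw , le = w , ew , Q′-outside w qw , subst₂ (λ a b → leM a (stretch G b v)) (sym μ′v) (sym (μ′-outside w qw)) le
          regress₁′ : owner0 v ≡ false → (∀ w → E G v w → Q′ w ≡ false → leM (μ′ v) (stretch G (μ′ w) v))
                                        × (∀ b → μ₀ v ≡ val b → Σ (Vec ℤ d) λ g → c ≡ b ⊕ g × leF (fin g) m)
          regress₁′ o = below , growth′
            where
              growth′ : ∀ b → μ₀ v ≡ val b → Σ (Vec ℤ d) λ g → c ≡ b ⊕ g × leF (fin g) m
              growth′ b μ₀v with proj₂ (regress₁ o) b μ₀v
              ... | g , c≡b⊕g , g≤level = g , c≡b⊕g , leF-trans g≤level level≤m
              below : ∀ w → E G v w → Q′ w ≡ false → leM (μ′ v) (stretch G (μ′ w) v)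
              below w ew q′w = by-Q (Q w) refl
                where
                  by-Q : ∀ x → Q w ≡ x → leM (μ′ v) (stretch G (μ′ w) v)
                  by-Q false qw = subst₂ (λ a b → leM a (stretch G b v)) (sym μ′v) (sym (μ′-outside w qw)) (proj₁ (regress₁ o) w ew qw)
                  by-Q true qw = kept-V1-removed-succ v w c q₀v qv μv o ew (proj₂ (regress₁ o)) qw q′w

      -- The regress inequality at v, together with the escape condition, makes the lift inflationary.
      bep-lift-inflationary : ∀ v → Q₀ v ≡ true → bep G μ Q v ≡ true → μ₀ v ≢ top → leM (μ₀ v) (μ′ v)
      bep-lift-inflationary v q₀v bv ¬top = by-owner (owner0 v) refl
        where
          qv = bep⊆Q μ Q v bv
          by-owner : ∀ x → owner0 v ≡ x → leM (μ₀ v) (μ′ v)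
          by-owner true o with regress-V0 v q₀v ¬top o
          ... | w , ew , μ₀≤w = by-Q (Q w) refl
            where
              by-Q : ∀ x → Q w ≡ x → leM (μ₀ v) (μ′ v)
              by-Q true qw with proj₂ (esc-view μ Q v (proj₁ (bep-view μ Q v bv)))
              ... | esc-V0 _ a = ⊥-elim (ltMᵇ-true⇒¬leM _ _ (all-true _ _ a w (∈-succIn⁺ v Q w ew qw))
                      (subst₂ (λ a z → leM a (stretch G z v)) (sym (proj₁ (inside v qv))) (sym (proj₁ (inside w qw))) μ₀≤w))
              ... | esc-V1 o′ _ = ⊥-elim (false≢true (trans (sym o′) o))
              by-Q false qw = leM-trans μ₀≤w (leM-trans (stretch-mono _ _ v (outside-inflated w qw))
                                (lift-V0-ub μ (bep G μ Q) (notIn G Q) v bv o w (∈-succIn⁺ v (notIn G Q) w ew (notIn⁺ Q w qw))))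
          by-owner false o = lift-V1-glb μ (bep G μ Q) (notIn G Q) v bv o (μ₀ v) λ w w∈ →
            let ew , nq = ∈-succIn⁻ v (notIn G Q) w w∈ in
            leM-trans (regress-V1 v q₀v ¬top o w ew) (stretch-mono _ _ v (outside-inflated w (notIn⁻ Q w nq)))

      bep-lift-witness : ∀ v → bep G μ Q v ≡ true → μ′ v ≢ top → Dplus G μ′ v →
        Σ (Fin n) λ w → E G v w × Q′ w ≡ false × leM (μ′ v) (stretch G (μ′ w) v)
      bep-lift-witness v bv ¬top dp with lift-cases μ (bep G μ Q) (notIn G Q) v bv
      ... | inj₁ p = ⊥-elim (dp (trans (cong (λ z → trunc G z v) p) (trunc-bot v)))
      ... | inj₂ (inj₁ p) = ⊥-elim (¬top p)
      ... | inj₂ (inj₂ (w , w∈ , p)) with ∈-succIn⁻ v (notIn G Q) w w∈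
      ...   | ew , nq = w , ew , Q′-outside w (notIn⁻ Q w nq) ,
              subst₂ (λ a z → leM a (stretch G z v)) (sym p) (sym (μ′-outside w (notIn⁻ Q w nq))) leM-refl

      bep-lift-V1 : ∀ v b c → Q₀ v ≡ true → bep G μ Q v ≡ true → μ₀ v ≡ val b → μ′ v ≡ val c → m ≡ fin (c ⊖ b) → owner0 v ≡ false →
        ∀ w → E G v w → Q′ w ≡ false → leM (μ′ v) (stretch G (μ′ w) v)
      bep-lift-V1 v b c q₀v bv μ₀v μ′v m≡c⊖b o w ew q′w = by-Q (Q w) refl
        where
          by-Q : ∀ x → Q w ≡ x → leM (μ′ v) (stretch G (μ′ w) v)
          by-Q false qw = subst (λ z → leM (μ′ v) (stretch G z v)) (sym (μ′-outside w qw))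
            (lift-V1-lb μ (bep G μ Q) (notIn G Q) v bv o w (∈-succIn⁺ v (notIn G Q) w ew (notIn⁺ Q w qw)))
          by-Q true qw with bep-lifted-by w (c ⊖ b) (removed⇒bep w qw q′w) m≡c⊖b
          ... | bw , _ , μ₀w , μ′w = subst₂ (λ a z → leM a (stretch G z v))
                  (sym (trans μ′v (cong val (sym (⊕-⊖-cancelˡ c b))))) (sym μ′w)
                  (regress-shift-leM b bw (c ⊖ b) (c ⊖ b) v (InMPlus-μ₀ v b μ₀v) (Q₀-nonzero v b q₀v μ₀v) regress-w LeV-refl)
            where
              regress-w : leM (val b) (stretch G (val bw) v)
              regress-w = subst₂ (λ a z → leM a (stretch G z v)) μ₀v μ₀w (regress-V1 v q₀v (λ t → case trans (sym μ₀v) t of λ ()) o w ew)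

      Lifted-new : ∀ v → Q₀ v ≡ true → bep G μ Q v ≡ true → Lifted m μ′ Q′ v
      Lifted-new v q₀v bv with bep-lift v bv
      ... | b , _ , μ₀v , lifting = liftedValue lifting , μ′v ,
              subst (leM (μ₀ v)) μ′v (bep-lift-inflationary v q₀v bv ¬top) ,
              (λ _ → bep-lift-witness v bv (λ t → case trans (sym μ′v) t of λ ())) , V1-case lifting
        where
          μ′v = liftedValue-eq lifting
          ¬top : μ₀ v ≢ top
          ¬top t = case trans (sym μ₀v) t of λ ()
          V1-case : (l : BepLift v b) → owner0 v ≡ false → (∀ w → E G v w → Q′ w ≡ false → leM (μ′ v) (stretch G (μ′ w) v))
                      × (∀ b′ → μ₀ v ≡ val b′ → Σ (Vec ℤ d) λ g → liftedValue l ≡ b′ ⊕ g × leF (fin g) m)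
          V1-case (inj₂ (o′ , _ , _)) o = ⊥-elim (false≢true (trans (sym o) o′))
          V1-case (inj₁ (c , μ′v≡c , m≡c⊖b)) o = bep-lift-V1 v b c q₀v bv μ₀v μ′v≡c m≡c⊖b o , growth
            where
              growth : ∀ b′ → μ₀ v ≡ val b′ → Σ (Vec ℤ d) λ g → c ≡ b′ ⊕ g × leF (fin g) m
              growth b′ μ₀v′ with val-injective (trans (sym μ₀v) μ₀v′)
              ... | refl = c ⊖ b , sym (⊕-⊖-cancelˡ c b) , subst (leF (fin (c ⊖ b))) (sym m≡c⊖b) LeV-refl

      lifted′ : ∀ v → Q₀ v ≡ true → Q′ v ≡ false → Lifted m μ′ Q′ v
      lifted′ v q₀v q′v = by-bep (bep G μ Q v) refl
        where
          by-bep : ∀ x → bep G μ Q v ≡ x → Lifted m μ′ Q′ v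
          by-bep true bv = Lifted-new v q₀v bv
          by-bep false bv = Lifted-kept v q₀v (trans (sym (nextQ-¬bep μ Q v bv)) q′v)

      removed-succ-forfeit : ∀ u w bu → μ′ u ≡ val bu → μ₀ u ≡ val bu → Q₀ u ≡ true → bep G μ Q w ≡ true →
        leM (val bu) (stretch G (μ₀ w) u) → leF m (diffM G (stretch G (μ′ w) u) (μ′ u))
      removed-succ-forfeit u w bu μ′u μ₀u q₀u bw regress-w with bep-lift w bw
      ... | _ , _ , _ , inj₂ (_ , _ , m≡negInf) rewrite m≡negInf = tt
      ... | _ , _ , _ , inj₁ (c , _ , m≡c⊖b) with bep-lifted-by w _ bw m≡c⊖b
      ...   | bw′ , _ , μ₀w , μ′w = subst (λ z → leF z (diffM G (stretch G (μ′ w) u) (μ′ u))) (sym m≡c⊖b)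
              (subst₂ (λ a z → leF (fin _) (diffM G (stretch G a u) z)) (sym μ′w) (sym μ′u)
                (regress-shift-leF bu bw′ _ u (InMPlus-μ₀ u bu μ₀u) (Q₀-nonzero u bu q₀u μ₀u)
                  (subst (λ z → leM (val bu) (stretch G z u)) μ₀w regress-w)))

      level′-V1 : ∀ u bu → Q′ u ≡ true → μ₀ u ≡ val bu → owner0 u ≡ false → ∀ x → x ∈ succForfeits μ′ u Q′ → leF m x
      level′-V1 u bu q′u μ₀u o x x∈ with ∈-map⁻ (λ w → diffM G (stretch G (μ′ w) u) (μ′ u)) x∈
      ... | w , w∈ , refl with ∈-succIn⁻ u (notIn G Q′) w w∈
      ...   | ew , nq′ = by-Q (Q w) refl
        where
          qu = proj₁ (nextQ-inside μ Q u q′u)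
          q₀u = proj₂ (inside u qu)
          ¬top : μ₀ u ≢ top
          ¬top t = case trans (sym μ₀u) t of λ ()
          by-Q : ∀ x → Q w ≡ x → leF m (diffM G (stretch G (μ′ w) u) (μ′ u))
          by-Q true qw = removed-succ-forfeit u w bu (trans (μ′-inside u q′u) (trans (proj₁ (inside u qu)) μ₀u)) μ₀u q₀u
            (removed⇒bep w qw (notIn⁻ Q′ w nq′)) (subst (λ z → leM z (stretch G (μ₀ w) u)) μ₀u (regress-V1 u q₀u ¬top o w ew))
          by-Q false qw = leF-trans m≤forfeits
            (subst₂ (λ a z → leF (foldr (minF G) posInf (succForfeits μ u Q)) (diffM G (stretch G a u) z))
              (sym (μ′-outside w qw)) (sym (μ′-inside u q′u))
              (MinF.fold-ub posInf (succForfeits μ u Q) _ (∈-map⁺ (λ w → diffM G (stretch G (μ w) u) (μ u)) w∈Q)))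
            where
              w∈Q = ∈-succIn⁺ u (notIn G Q) w ew (notIn⁺ Q w qw)
              m≤forfeits = subst (leF m) (bef-V1 μ Q u (V1-esc u w qu o w∈Q) o) (m≤bef u qu)

      -- If u did not escape Q, it has a successor w ∈ Q with μ w + u ≥ μ u, and w was removed now.
      level′-V0 : ∀ u bu → Q′ u ≡ true → esc G μ′ Q′ u ≡ true → μ₀ u ≡ val bu → owner0 u ≡ true →
        leF m (foldr (maxF G) negInf (succForfeits μ′ u Q′))
      level′-V0 u bu q′u esc′ μ₀u o = by-esc (esc G μ Q u) refl
        where
          qu = proj₁ (nextQ-inside μ Q u q′u)
          μu≡μ₀u = proj₁ (inside u qu)
          μ′u≡μu = μ′-inside u q′u
          below-max : ∀ w → w ∈ succIn G u (notIn G Q′) →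
            leF (diffM G (stretch G (μ′ w) u) (μ′ u)) (foldr (maxF G) negInf (succForfeits μ′ u Q′))
          below-max w w∈ = MaxF.fold-ub negInf (succForfeits μ′ u Q′) _ (∈-map⁺ (λ w → diffM G (stretch G (μ′ w) u) (μ′ u)) w∈)
          by-esc : ∀ x → esc G μ Q u ≡ x → leF m (foldr (maxF G) negInf (succForfeits μ′ u Q′))
          by-esc true escu with subst (leF m) (bef-V0 μ Q u escu o) (m≤bef u qu) | MaxF.fold-sel negInf (succForfeits μ u Q)
          ... | m≤max | inj₁ p rewrite leF-negInf m (subst (leF m) p m≤max) = tt
          ... | m≤max | inj₂ (x , x∈ , p) with ∈-map⁻ (λ w → diffM G (stretch G (μ w) u) (μ u)) x∈
          ...   | w , w∈ , refl with ∈-succIn⁻ u (notIn G Q) w w∈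
          ...     | ew , nq = leF-trans (subst (leF m) p m≤max)
                      (subst₂ (λ a z → leF (diffM G (stretch G a u) z) (foldr (maxF G) negInf (succForfeits μ′ u Q′)))
                        (μ′-outside w (notIn⁻ Q w nq)) μ′u≡μu
                        (below-max w (∈-succIn⁺ u (notIn G Q′) w ew (notIn⁺ Q′ w (Q′-outside w (notIn⁻ Q w nq))))))
          by-esc false ¬escu with noEsc-view μ Q u qu ¬escu
          ... | noEsc-V1 o′ _ = ⊥-elim (false≢true (trans (sym o′) o))
          ... | noEsc-V0 _ a with all-false _ _ a
          ...   | w , w∈ , ¬lt with ∈-succIn⁻ u Q w w∈
          ...     | ew , qw = by-Q′ (Q′ w) refl
            where
              by-Q′ : ∀ x → Q′ w ≡ x → leF m (foldr (maxF G) negInf (succForfeits μ′ u Q′))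
              by-Q′ true q′w with proj₂ (esc-view μ′ Q′ u esc′)
              ... | esc-V1 o′ _ = ⊥-elim (false≢true (trans (sym o′) o))
              ... | esc-V0 _ a′ = ⊥-elim (false≢true (trans (sym ¬lt)
                      (subst₂ (λ a z → ltMᵇ G (stretch G a u) z ≡ true) (μ′-inside w q′w) μ′u≡μu
                        (all-true _ _ a′ w (∈-succIn⁺ u Q′ w ew q′w)))))
              by-Q′ false q′w = leF-trans
                (removed-succ-forfeit u w bu (trans μ′u≡μu (trans μu≡μ₀u μ₀u)) μ₀u (proj₂ (inside u qu)) (removed⇒bep w qw q′w)
                  (subst₂ (λ a z → leM a (stretch G z u)) (trans μu≡μ₀u μ₀u) (proj₁ (inside w qw)) (ltMᵇ-false _ _ ¬lt)))
                (below-max w (∈-succIn⁺ u (notIn G Q′) w ew (notIn⁺ Q′ w q′w)))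

      level′ : ∀ u → Q′ u ≡ true → leF m (bef G μ′ Q′ u)
      level′ u q′u = by-esc (esc G μ′ Q′ u) refl
        where
          by-esc : ∀ x → esc G μ′ Q′ u ≡ x → leF m (bef G μ′ Q′ u)
          by-esc false e = subst (leF m) (sym (bef-noEsc μ′ Q′ u e)) (leF-posInf m)
          by-esc true esc′ with μ₀ u in μ₀u | bef G μ′ Q′ u | bef-view μ′ Q′ u esc′
          ... | top | _ | _ = ⊥-elim (esc⇒¬top μ′ Q′ inside′ tops′ u esc′ μ₀u)
          ... | val bu | _ | bef-min o = MinF.fold-all (leF m) posInf (succForfeits μ′ u Q′) (leF-posInf m) (level′-V1 u bu q′u μ₀u o)
          ... | val bu | _ | bef-max o = level′-V0 u bu q′u esc′ μ₀u o

      invariant-step : Invariant k μ′ Q′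
      invariant-step = record
        { level = m
        ; isMF = lift-IsMF μ (bep G μ Q) (notIn G Q) isMF
        ; inside = inside′
        ; outside-Q₀ = outside-Q₀′
        ; tops-inside = tops′
        ; lifted = lifted′
        ; level≤bef = level′
        ; count≤fuel = count≤fuel′
        }

    QDConclusion : MeasureFun G → Set
    QDConclusion F = _⊑_ G μ₀ F × IsMF G F × QDMeasure G F

    isTopᵇ : Msr d → Bool
    isTopᵇ top = true
    isTopᵇ (val _) = false

    isTopᵇ-true : ∀ m → isTopᵇ m ≡ true → m ≡ top
    isTopᵇ-true top _ = refl

    isTopᵇ-false : ∀ m → isTopᵇ m ≡ false → m ≢ top
    isTopᵇ-false (val _) _ ()

    pick : (Fin n → Bool) → List (Fin n) → Fin n → Fin n
    pick p [] dflt = dflt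
    pick p (x ∷ l) dflt = if p x then x else pick p l dflt

    pick-ok : ∀ p l dflt x → x ∈ l → p x ≡ true → pick p l dflt ∈ l × p (pick p l dflt) ≡ true
    pick-ok p (y ∷ l) dflt x mx px with p y in e
    ... | true = here refl , e
    ... | false with mx
    ... | here refl = ⊥-elim (false≢true (trans (sym e) px))
    ... | there m′ with pick-ok p l dflt x m′ px
    ... | a , b = there a , b

    valOrZeros : Msr d → Vec ℤ d
    valOrZeros (val b) = b
    valOrZeros top = zeros

    regress-unclipped : ∀ b b′ v → InMPlus G b → b ≢ zeros → leM (val b) (stretch G (val b′) v) → LeV b (b′ ⊕ δ G (pr v))
    regress-unclipped b b′ v ib nz le with stretch G (val b′) v | stretch-view b′ v
    ... | _ | unclipped _ = le
    ... | _ | clipped _ = ⊥-elim (nz (LeV-antisym le (InMPlus⇒zeros-LeV b ib)))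

    module Termination (k : ℕ) (μ : MeasureFun G) (Q : Subset G) (I : Invariant k μ Q)
                 (no-escape : ∀ u → Q u ≡ true → esc G μ Q u ≡ false) where
      open Invariant I

      F : MeasureFun G
      F = finish G μ Q

      D0F⇒Q : ∀ v → D0 G F v → Q v ≡ true
      D0F⇒Q v h = by-Q (Q v) refl
        where
          by-Q : ∀ x → Q v ≡ x → Q v ≡ true
          by-Q true e = e
          by-Q false e with outside-val I v e
          ... | c , ec with trans (sym (cong (λ z → trunc G z v) (trans (finish-outside μ Q v e) ec))) h
          ... | ()

      Q⇒D0F : ∀ v → Q v ≡ true → D0 G F v
      Q⇒D0F v q = top⇒D0 F v (finish-inside μ Q v q)

      inflationary : _⊑_ G μ₀ F
      inflationary v = leM⇒≤M _ _ (by-Q (Q v) refl)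
        where
          by-Q : ∀ x → Q v ≡ x → leM (μ₀ v) (F v)
          by-Q true e = subst (leM (μ₀ v)) (sym (finish-inside μ Q v e)) (leM-top _)
          by-Q false e = subst (leM (μ₀ v)) (sym (finish-outside μ Q v e)) (by-Q₀ (Q₀ v) refl)
            where
              by-Q₀ : ∀ x → Q₀ v ≡ x → leM (μ₀ v) (μ v)
              by-Q₀ false q0 = subst (leM (μ₀ v)) (sym (proj₁ (outside-Q₀ v q0))) leM-refl
              by-Q₀ true q0 with lifted v q0 e
              ... | c , ec , le , _ = subst (leM (μ₀ v)) (sym ec) le

      RegressAt : Fin n → Set
      RegressAt v = (V0 G v → Σ (Fin n) λ w → E G v w × _≤M_ G (F v) (stretch G (F w) v))
              × (V1 G v → ∀ w → E G v w → _≤M_ G (F v) (stretch G (F w) v))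

      regressF : Regress G F
      regressF v dp nd = by-Q (Q v) refl
        where
          by-Q : ∀ x → Q v ≡ x → RegressAt v
          by-Q true e = ⊥-elim (nd (Q⇒D0F v e))
          by-Q false e = by-Q₀ (Q₀ v) refl
            where
              Fv : F v ≡ μ v
              Fv = finish-outside μ Q v e
              by-Q₀ : ∀ x → Q₀ v ≡ x → RegressAt v
              by-Q₀ false q0 = ⊥-elim (false≢true (trans (sym q0) (Dplus⇒DplusB μ₀ v (Dplus-resp F μ₀ v (sym (trans Fv (proj₁ (outside-Q₀ v q0)))) dp))))
              by-Q₀ true q0 with lifted v q0 e
              ... | c , ec , le , witness₀ , regress₁ = V0-case , V1-case
                where
                  V0-case : V0 G v → Σ (Fin n) λ w → E G v w × _≤M_ G (F v) (stretch G (F w) v)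
                  V0-case o with witness₀ o (λ h → dp (subst (λ z → trunc G z v ≡ botM G) (sym Fv) h))
                  ... | w , ew , qw , lw = w , ew , leM⇒≤M _ _ (subst₂ (λ a z → leM a (stretch G z v)) (sym Fv) (sym (finish-outside μ Q w qw)) lw)
                  V1-case : V1 G v → ∀ w → E G v w → _≤M_ G (F v) (stretch G (F w) v)
                  V1-case o w ew = leM⇒≤M _ _ (by-Qw (Q w) refl)
                    where
                      by-Qw : ∀ x → Q w ≡ x → leM (F v) (stretch G (F w) v)
                      by-Qw true qw = subst (λ z → leM (F v) (stretch G z v)) (sym (finish-inside μ Q w qw)) (leM-top _)
                      by-Qw false qw = subst₂ (λ a z → leM a (stretch G z v)) (sym Fv) (sym (finish-outside μ Q w qw)) (proj₁ (regress₁ o) w ew qw)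

      nonDecreasing : Fin n → Fin n → Bool
      nonDecreasing v w = not (ltMᵇ G (stretch G (μ w) v) (μ v))

      -- As v does not escape Q, some successor in Q has a stretched measure not below μ v.
      σ : Fin n → Fin n
      σ v = if isTopᵇ (μ₀ v) then σ₀ v else pick (nonDecreasing v) (succIn G v Q) (τ-any v)

      σ-top : ∀ v → μ₀ v ≡ top → σ v ≡ σ₀ v
      σ-top v t rewrite t = refl

      σ-ok : ∀ v → Q v ≡ true → owner0 v ≡ true → μ₀ v ≢ top →
        edge v (σ v) ≡ true × Q (σ v) ≡ true × leM (μ₀ v) (stretch G (μ₀ (σ v)) v)
      σ-ok v qv o nt with isTopᵇ (μ₀ v) in et
      ... | true = ⊥-elim (nt (isTopᵇ-true _ et))
      ... | false with noEsc-view μ Q v qv (no-escape v qv)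
      ... | noEsc-V1 o′ _ = ⊥-elim (false≢true (trans (sym o′) o))
      ... | noEsc-V0 _ a with all-false _ _ a
      ... | w , mw , lf with pick-ok (nonDecreasing v) (succIn G v Q) (τ-any v) w mw (cong not lf)
      ... | ms , ps with ∈-succIn⁻ v Q _ ms
      ... | es , qs = es , qs , subst₂ (λ a z → leM a (stretch G z v)) (proj₁ (inside v qv)) (proj₁ (inside _ qs))
                        (ltMᵇ-false _ _ (notT ps))
        where notT : ∀ {b} → not b ≡ true → b ≡ false
              notT {false} _ = refl

      V1-closed : ∀ v w → Q v ≡ true → owner0 v ≡ false → edge v w ≡ true → Q w ≡ true
      V1-closed v w qv o ew with noEsc-view μ Q v qv (no-escape v qv)
      ... | noEsc-V0 o′ _ = ⊥-elim (false≢true (trans (sym o) o′))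
      ... | noEsc-V1 _ a = by-Q (Q w) refl
        where
          by-Q : ∀ x → Q w ≡ x → Q w ≡ true
          by-Q true e = e
          by-Q false e with subst (w ∈_) (any-const-false _ a) (∈-succIn⁺ v (notIn G Q) w ew (notIn⁺ Q w e))
          ... | ()

      σ-valid : ∀ v → D0 G F v → V0 G v → E G v (σ v)
      σ-valid v d o = by-top (isTopᵇ (μ₀ v)) refl
        where
          by-top : ∀ x → isTopᵇ (μ₀ v) ≡ x → E G v (σ v)
          by-top true e = subst (λ z → edge v z ≡ true) (sym (σ-top v (isTopᵇ-true _ e))) (dominion-σ₀-edge v (isTopᵇ-true _ e) o)
          by-top false e = proj₁ (σ-ok v (D0F⇒Q v d) o (isTopᵇ-false _ e))

      module Plays (τ : Fin n → Fin n) (τ-valid : ∀ v → D0 G F v → V1 G v → E G v (τ v)) where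

        S : Fin n → Fin n
        S u = if owner0 u then σ u else τ u

        play≡iterate : ∀ v t → play G σ τ v t ≡ iterate S v t
        play≡iterate v zero = refl
        play≡iterate v (suc t) = cong S (play≡iterate v t)

        S-V0 : ∀ u → owner0 u ≡ true → S u ≡ σ u
        S-V0 u o = if-true (owner0 u) _ _ o

        S-V1 : ∀ u → owner0 u ≡ false → S u ≡ τ u
        S-V1 u o = if-false (owner0 u) _ _ o

        S-closed : ∀ u → Q u ≡ true → Q (S u) ≡ true
        S-closed u qu = by-owner (owner0 u) refl
          where
            by-owner : ∀ x → owner0 u ≡ x → Q (S u) ≡ true
            by-owner true o = subst (λ z → Q z ≡ true) (sym (S-V0 u o)) (by-top (isTopᵇ (μ₀ u)) refl)
              where
                by-top : ∀ x → isTopᵇ (μ₀ u) ≡ x → Q (σ u) ≡ true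
                by-top true e = subst (λ z → Q z ≡ true) (sym (σ-top u (isTopᵇ-true _ e))) (tops-inside _ (dominion-σ₀-top u (isTopᵇ-true _ e) o))
                by-top false e = proj₁ (proj₂ (σ-ok u qu o (isTopᵇ-false _ e)))
            by-owner false o = subst (λ z → Q z ≡ true) (sym (S-V1 u o)) (V1-closed u (τ u) qu o (τ-valid u (Q⇒D0F u qu) o))

        S-top : ∀ u → μ₀ u ≡ top → μ₀ (S u) ≡ top
        S-top u t = by-owner (owner0 u) refl
          where
            by-owner : ∀ x → owner0 u ≡ x → μ₀ (S u) ≡ top
            by-owner true o = subst (λ z → μ₀ z ≡ top) (sym (trans (S-V0 u o) (σ-top u t))) (dominion-σ₀-top u t o)
            by-owner false o = subst (λ z → μ₀ z ≡ top) (sym (S-V1 u o)) (dominion-V1-top u (τ u) t o (τ-valid u (Q⇒D0F u (tops-inside u t)) o))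

        iterate-inside : ∀ v → Q v ≡ true → ∀ t → Q (iterate S v t) ≡ true
        iterate-inside v qv zero = qv
        iterate-inside v qv (suc t) = S-closed _ (iterate-inside v qv t)

        iterate-top : ∀ v → μ₀ v ≡ top → ∀ t → μ₀ (iterate S v t) ≡ top
        iterate-top v tv zero = tv
        iterate-top v tv (suc t) = S-top _ (iterate-top v tv t)

        iterate≡play-σ₀ : ∀ y → μ₀ y ≡ top → ∀ t → iterate S y t ≡ play G σ₀ τ y t
        iterate≡play-σ₀ y ty zero = refl
        iterate≡play-σ₀ y ty (suc t) = trans (cong S ih) (by-owner (owner0 p) refl)
          where
            ih = iterate≡play-σ₀ y ty t
            p = play G σ₀ τ y t
            by-owner : ∀ x → owner0 p ≡ x → S p ≡ (if owner0 p then σ₀ p else τ p)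
            by-owner true o = trans (S-V0 p o) (trans (σ-top p (subst (λ z → μ₀ z ≡ top) ih (iterate-top y ty t))) (sym (if-true (owner0 p) _ _ o)))
            by-owner false o = trans (S-V1 p o) (sym (if-false (owner0 p) _ _ o))

        S-regress : ∀ u → Q u ≡ true → μ₀ u ≢ top → μ₀ (S u) ≢ top →
          LeV (valOrZeros (μ₀ u)) (valOrZeros (μ₀ (S u)) ⊕ δ G (pr u))
        S-regress u qu ¬top ¬top-S = unclip (μ₀ u) refl (μ₀ (S u)) refl
          where
            regress-S : leM (μ₀ u) (stretch G (μ₀ (S u)) u)
            regress-S = by-owner (owner0 u) refl
              where
                by-owner : ∀ x → owner0 u ≡ x → leM (μ₀ u) (stretch G (μ₀ (S u)) u)
                by-owner true o = subst (λ z → leM (μ₀ u) (stretch G (μ₀ z) u)) (sym (S-V0 u o)) (proj₂ (proj₂ (σ-ok u qu o ¬top)))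
                by-owner false o = subst (λ z → leM (μ₀ u) (stretch G (μ₀ z) u)) (sym (S-V1 u o))
                  (regress-V1 u (proj₂ (inside u qu)) ¬top o (τ u) (τ-valid u (Q⇒D0F u qu) o))
            unclip : ∀ x → μ₀ u ≡ x → ∀ x′ → μ₀ (S u) ≡ x′ → LeV (valOrZeros (μ₀ u)) (valOrZeros (μ₀ (S u)) ⊕ δ G (pr u))
            unclip top e _ _ = ⊥-elim (¬top e)
            unclip (val b) e top e′ = ⊥-elim (¬top-S e′)
            unclip (val b) e (val b′) e′ = subst₂ LeV (sym (cong valOrZeros e)) (cong (λ z → valOrZeros z ⊕ δ G (pr u)) (sym e′))
              (regress-unclipped b b′ u (InMPlus-μ₀ u b e) (Q₀-nonzero u b (proj₂ (inside u qu)) e)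
                (subst₂ (λ a z → leM a (stretch G z u)) e e′ regress-S))

        -- S cannot leave the ⊤ positions, so a cycle avoiding ⊤ at one position avoids it everywhere.
        cycle-¬top : ∀ y L′ → iterate S y (suc L′) ≡ y → μ₀ y ≢ top → ∀ t → μ₀ (iterate S y t) ≢ top
        cycle-¬top y L′ cyc ¬top t t-top = ¬top (subst (λ z → μ₀ z ≡ top) back (iterate-top _ t-top (L′ * t)))
          where
            open ≡-Reasoning
            back : iterate S (iterate S y t) (L′ * t) ≡ y
            back = begin
              iterate S (iterate S y t) (L′ * t) ≡⟨ sym (iterate-+ S y t (L′ * t)) ⟩
              iterate S y (t + L′ * t)            ≡⟨ cong (iterate S y) (trans (ℕP.*-comm (suc L′) t) (sym (ℕP.+-identityʳ _))) ⟩
              iterate S y (t * suc L′ + 0)        ≡⟨ iterate-periodic S y L′ cyc t 0 ⟩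
              y                                   ∎

        -- Every play under σ ends in a cycle; on ⊤ positions σ plays the dominion strategy σ₀.
        iterate-EvenPriority : ∀ v → Q v ≡ true → EvenPriority G (iterate S v)
        iterate-EvenPriority v qv with iterate-cycle S v
        ... | a , L′ , cyc = by-top (μ₀ y) refl
          where
            y = iterate S v a
            y-inside : ∀ t → Q (iterate S y t) ≡ true
            y-inside t = subst (λ z → Q z ≡ true) (iterate-+ S v a t) (iterate-inside v qv (a + t))
            τ-valid₀ : ∀ u → D0 G μ₀ u → V1 G u → E G u (τ u)
            τ-valid₀ u d o = τ-valid u (Q⇒D0F u (tops-inside u (D0⇒top μ₀ u d))) o
            by-top : ∀ x → μ₀ y ≡ x → EvenPriority G (iterate S v)
            by-top top ty = EvenPriority-suffix (iterate S v) (play G σ₀ τ y) a (λ t → trans (iterate-+ S v a t) (iterate≡play-σ₀ y ty t))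
                              (proj₂ (σ₀-wins τ τ-valid₀ y (top⇒D0 μ₀ y ty)))
            by-top (val _) ey = EvenPriority-suffix (iterate S v) (iterate S y) a (iterate-+ S v a) Cyc.cycle-EvenPriority
              where
                ¬top = cycle-¬top y L′ cyc λ t → case trans (sym ey) t of λ ()
                module Cyc = RegressCycle S y L′ cyc (valOrZeros ∘ μ₀) (λ t → S-regress _ (y-inside t) (¬top t) (¬top (suc t)))

      dominionF : Dominion0 G (D0 G F)
      dominionF = σ , σ-valid , λ τ τ-valid v dv →
        let open Plays τ τ-valid in
        (λ t → Q⇒D0F _ (subst (λ z → Q z ≡ true) (sym (play≡iterate v t)) (iterate-inside v (D0F⇒Q v dv) t))) ,
        EvenPriority-suffix (play G σ τ v) (iterate S v) 0 (play≡iterate v) (iterate-EvenPriority v (D0F⇒Q v dv))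

      result : QDConclusion F
      result = inflationary , finish-IsMF μ Q isMF , regressF , dominionF

    invariant-init : Invariant (suc n) μ₀ Q₀
    invariant-init = record
      { level = negInf
      ; isMF = im₀
      ; inside = λ v q → refl , q
      ; outside-Q₀ = λ v q → refl , q
      ; tops-inside = λ v t → Dplus⇒DplusB μ₀ v (top⇒Dplus μ₀ v t)
      ; lifted = λ v q0 qv → ⊥-elim (false≢true (trans (sym qv) q0))
      ; level≤bef = λ u _ → tt
      ; count≤fuel = ℕP.m≤n⇒m≤1+n (count≤n Q₀)
      }

    prg₊-quasiDominion : QDConclusion (prg₊ G μ₀)
    prg₊-quasiDominion = PrgLoopInduction.prgLoop-induction Invariant QDConclusion (λ k μ Q I h → Step.invariant-step k μ Q I h) no-bep no-fuel
      (suc n) μ₀ Q₀ invariant-init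
      where
        no-bep : ∀ k μ Q → Invariant (suc k) μ Q → any (bep G μ Q) (allFin n) ≡ false → QDConclusion (finish G μ Q)
        no-bep k μ Q I h = Termination.result (suc k) μ Q I no-escape
          where
            no-escape : ∀ u → Q u ≡ true → esc G μ Q u ≡ false
            no-escape u qu with esc G μ Q u in e
            ... | false = refl
            ... | true = ⊥-elim (false≢true (trans (sym h) (esc⇒bep μ Q u e)))
        no-fuel : ∀ μ Q → Invariant 0 μ Q → QDConclusion (finish G μ Q)
        no-fuel μ Q I = Termination.result 0 μ Q I no-escape
          where
            no-escape : ∀ u → Q u ≡ true → esc G μ Q u ≡ false
            no-escape u qu = case ℕP.≤-trans (count-pos Q u qu) (Invariant.count≤fuel I) of λ ()

lemma25 : (G : Game) →
    (∀ (μ : MeasureFun G) → IsMF G μ → MFBot G μ →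
       IsMF G (prg₊ G μ) × MFBot G (prg₊ G μ))
  × (∀ (μ : MeasureFun G) → IsMF G μ → QDMeasure G μ →
       _⊑_ G μ (prg₊ G μ) × IsMF G (prg₊ G μ) × QDMeasure G (prg₊ G μ))
  × (∀ (μ : MeasureFun G) → IsMF G μ → SimpleMF G μ →
       IsMF G (prg₊ G μ) × SimpleMF G (prg₊ G μ))
  × (∀ (μ : MeasureFun G) → IsMF G μ → (∀ v → prg₊ G μ v ≡ μ v) →
       ProgressOnDplus G μ)
lemma25 G = prg₊-MFBot G
          , QuasiDominion.prg₊-quasiDominion G
          , prg₊-simple G
          , λ μ _ → prg₊-fixpoint-progress G μ
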